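{- Let $\omega$ be a finite permutation of the positive integers and let $\mathcal T_\omega$ be its tower diagram. Then the reading map $T\mapsto\mathrm{Read}(T)$ is a bijection from the set $\mathrm{STT}(\mathcal T_\omega)$ of standard tower tableaux of shape $\mathcal T_\omega$ onto the set $\mathrm{Red}(\omega)$ of reduced words of $\omega$, with inverse $\alpha\mapsto R(\alpha)$ given by the SR algorithm.
   Context: $s_i$ denotes the adjacent transposition $(i,i+1)$ of the positive integers; a finite permutation is a bijection of the positive integers fixing all but finitely many points. A reduced word of $\omega$ is a word $\alpha_1\cdots\alpha_\ell$ of positive integers with $\omega=s_{\alpha_1}\cdots s_{\alpha_\ell}$ and $\ell$ minimal. A cell is a pair $(i,j)$ of integers with $i\ge 1$, $j\ge 0$. A tower diagram is a finite set $\mathcal T$ of cells such that $(i,j)\in\mathcal T$ and $0\le k\le j$ imply $(i,k)\in\mathcal T$. The cell $(i,j)$ lies on the diagonal $x+y=i+j$. Flight paths (recursive): a cell $(i,j)\in\mathcal T$ has a flight path in $\mathcal T$ if either (F1) there is no cell $(i',j')\in\mathcal T$ with $i'<i$ and $i'+j'=i+j-1$ (flight path $\{(i,j)\}$), or (F2) such cells exist and, letting $(i',j')$ be the one with largest $i'$, $(i',j')$ has a flight path and $(i',j'+1)\in\mathcal T$ (flight path $\{(i,j),(i',j'+1)\}\cup\mathrm{flightpath}((i',j'),\mathcal T)$). The flight number of such a cell is $a+b$ for $(a,b)$ the lexicographically smallest element of its flight path. A corner cell of $\mathcal T$ is a cell $(i,j)\in\mathcal T$ with $(i,j+1)\notin\mathcal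 T$ having a flight path. Sliding: for a positive integer $\alpha$, $\alpha^{\searrow}\mathcal T$ is computed by the procedure $P(\gamma,m)$ started at $\gamma=\alpha$, $m=1$: (S1) if no cell $(i,j)\in\mathcal T$ with $i\ge m$ lies on $x+y=\gamma-1$: (a) if $(\gamma,0)\notin\mathcal T$ the result is $\mathcal T\cup\{(\gamma,0)\}$; (b) if $(\gamma,0)\in\mathcal T$, $(\gamma,1)\notin\mathcal T$ the slide terminates (without result); (c) if $(\gamma,0),(\gamma,1)\in\mathcal T$, continue with $P(\gamma+1,\gamma+1)$. (S2) Otherwise let $i\ge m$ be smallest with $(i,\gamma-1-i)\in\mathcal T$: (a) if $(i,\gamma-i)\notin\mathcal T$ the result is $\mathcal T\cup\{(i,\gamma-i)\}$; (b) if $(i,\gamma-i)\in\mathcal T$, $(i,\gamma-i+1)\notin\mathcal T$ the slide terminates; (c) if both are in $\mathcal T$, continue with $P(\gamma+1,i+1)$. SR algorithm on a word $\alpha_1\cdots\alpha_n$: $\mathcal T^{(0)}=\varnothing$, $\mathcal T^{(k)}=\alpha_k^{\searrow}\mathcal T^{(k-1)}=\mathcal T^{(k-1)}\cup\{d_k\}$ (if no slide terminates); the recording tableau $R(\alpha)$ labels $d_k$ by $k$ and has shape $\mathcal T^{(n)}$. For a reduced word $\alpha$ the SR algorithm does not terminate, and the tower diagram $\mathcal T_\omega$ of $\omega$ is $\mathrm{shape}(R(\alpha))$ for any reduced word $\alpha$ of $\omega$ (independent of the choice). A standard tower tableau of shape $\mathcal T$ ($|\mathcal T|=n$) is a bijection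 $f:\mathcal T\to\{1,\dots,n\}$ such that for each $a$, $\mathcal T_{\le a}=f^{ -1}(\{1,\dots,a\})$ is a tower diagram and $f^{ -1}(a)$ is a corner cell of $\mathcal T_{\le a}$. Its reading word is $\mathrm{Read}(f)=\alpha_1\cdots\alpha_n$ with $\alpha_k$ the flight number of $f^{ -1}(k)$ in $\mathcal T_{\le k}$. -}

module Defs where

open import Data.Nat using (ℕ; zero; suc; _+_; _∸_; _≤_; _<_; _≡ᵇ_; _<ᵇ_)
open import Data.Bool using (Bool; true; false; if_then_else_; not; _∧_; _∨_)
open import Data.Maybe using (Maybe; just; nothing; fromMaybe)
import Data.Maybe as Maybe
open import Data.Product using (Σ; ∃; _×_; _,_; proj₁; proj₂)
open import Data.List using (List; []; _∷_; _++_; [_]; length; take; lookup; foldr)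
open import Data.List.Relation.Unary.All using (All)
open import Data.List.Relation.Unary.Unique.Propositional using (Unique)
open import Data.List.Membership.Propositional using (_∈_; _∉_)
open import Data.Fin using (Fin; toℕ)
open import Relation.Binary.PropositionalEquality using (_≡_)
open import Function.Bundles using (_⇔_)

-- Finite permutations of the positive integers.
-- The positive integers are represented by the elements n ≥ 1 of ℕ;
-- the auxiliary point 0 is required to be fixed.

record FinPerm : Set where
  field
    fun    : ℕ → ℕ
    inv    : ℕ → ℕ
    fun∘inv : ∀ n → fun (inv n) ≡ n
    inv∘fun : ∀ n → inv (fun n) ≡ n
    fix0   : fun 0 ≡ 0
    bound  : ℕ
    fixes  : ∀ n → bound ≤ n → fun n ≡ n

s : ℕ → ℕ → ℕ
s i x = if x ≡ᵇ i then suc i else (if x ≡ᵇ suc i then i else x)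

evalWord : List ℕ → ℕ → ℕ
evalWord []       x = x
evalWord (a ∷ as) x = s a (evalWord as x)

IsWordOf : FinPerm → List ℕ → Set
IsWordOf ω α = All (1 ≤_) α × (∀ n → evalWord α n ≡ FinPerm.fun ω n)

IsReducedWord : FinPerm → List ℕ → Set
IsReducedWord ω α = IsWordOf ω α × (∀ β → IsWordOf ω β → length α ≤ length β)

Cell : Set
Cell = ℕ × ℕ

_==c_ : Cell → Cell → Bool
(a , b) ==c (c , d) = (a ≡ᵇ c) ∧ (b ≡ᵇ d)

memb : Cell → List Cell → Bool
memb x []       = false
memb x (y ∷ ys) = (x ==c y) ∨ memb x ys

IsTowerDiagram : List Cell → Set
IsTowerDiagram T =
  (∀ {i j} → (i , j) ∈ T → 1 ≤ i) ×
  (∀ {i j k} → (i , j) ∈ T → k ≤ j → (i , k) ∈ T)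

findLargest : List Cell → (d k : ℕ) → Maybe ℕ
findLargest T d zero    = nothing
findLargest T d (suc k) =
  if memb (suc k , d ∸ suc k) T then just (suc k) else findLargest T d k

-- flight path with fuel; the fuel i (the column of the cell) suffices,
-- since columns strictly decrease along the recursion.
flightPathF : ℕ → List Cell → Cell → Maybe (List Cell)
flightPathF zero    T c       = nothing
flightPathF (suc n) T (i , j) with findLargest T (i + j ∸ 1) (i ∸ 1)
... | nothing = just ((i , j) ∷ [])
... | just i' =
  if memb (i' , suc (i + j ∸ 1 ∸ i')) T
  then Maybe.map (λ p → (i , j) ∷ (i' , suc (i + j ∸ 1 ∸ i')) ∷ p)
                 (flightPathF n T (i' , i + j ∸ 1 ∸ i'))
  else nothing

-- flightPath T c ≡ just p  iff  c has flight path (the set of) p in T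
flightPath : List Cell → Cell → Maybe (List Cell)
flightPath T (i , j) = flightPathF i T (i , j)

_<lex_ : Cell → Cell → Bool
(a , b) <lex (c , d) = (a <ᵇ c) ∨ ((a ≡ᵇ c) ∧ (b <ᵇ d))

lexMin : Cell → List Cell → Cell
lexMin x []       = x
lexMin x (y ∷ ys) = lexMin (if y <lex x then y else x) ys

flightNumber : List Cell → Cell → Maybe ℕ
flightNumber T c with flightPath T c
... | nothing        = nothing
... | just []        = nothing
... | just (x ∷ xs)  = just (proj₁ (lexMin x xs) + proj₂ (lexMin x xs))

HasFlightPath : List Cell → Cell → Set
HasFlightPath T c = ∃ λ p → flightPath T c ≡ just p

IsCorner : List Cell → Cell → Set
IsCorner T (i , j) = (i , j) ∈ T × (i , suc j) ∉ T × HasFlightPath T (i , j)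

-- Standard tower tableaux.  A bijection f : 𝒯 → {1,…,n} is encoded by
-- the list of cells f⁻¹(1), …, f⁻¹(n) (no repetitions, underlying set 𝒯).

IsSTT : (Cell → Set) → List Cell → Set
IsSTT 𝒯 cs =
  Unique cs ×
  (∀ x → (x ∈ cs) ⇔ 𝒯 x) ×
  (∀ (k : Fin (length cs)) →
     IsTowerDiagram (take (suc (toℕ k)) cs) ×
     IsCorner (take (suc (toℕ k)) cs) (lookup cs k))

-- reading word (value 0 used only if a flight number is undefined,
-- which never happens for standard tower tableaux)
readAux : List Cell → List Cell → List ℕ
readAux pre []       = []
readAux pre (x ∷ xs) =
  fromMaybe 0 (flightNumber (pre ++ [ x ]) x) ∷ readAux (pre ++ [ x ]) xs

Read : List Cell → List ℕ
Read cs = readAux [] cs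

findSmallest : List Cell → (d i cnt : ℕ) → Maybe ℕ
findSmallest T d i zero      = nothing
findSmallest T d i (suc cnt) =
  if memb (i , d ∸ i) T then just i else findSmallest T d (suc i) cnt

-- procedure P(γ, m) with fuel; returns the added cell, or nothing if the
-- slide terminates.  Cells on diagonal γ-1 with column ≥ m have column in
-- {m, …, γ-1}.
slideP : ℕ → List Cell → (γ m : ℕ) → Maybe Cell
slideP zero     T γ m = nothing
slideP (suc f)  T γ m with findSmallest T (γ ∸ 1) m (γ ∸ m)
... | nothing =
  if not (memb (γ , 0) T) then just (γ , 0)
  else if not (memb (γ , 1) T) then nothing
  else slideP f T (suc γ) (suc γ)
... | just i =
  if not (memb (i , γ ∸ i) T) then just (i , γ ∸ i)
  else if not (memb (i , suc (γ ∸ i)) T) then nothing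
  else slideP f T (suc γ) (suc i)

-- sum of diagonals of the cells; each continuation step of P needs a cell
-- on a strictly larger diagonal, so sumDiag T + 1 is enough fuel.
sumDiag : List Cell → ℕ
sumDiag = foldr (λ c n → proj₁ c + proj₂ c + n) 0

slideCell : ℕ → List Cell → Maybe Cell
slideCell α T = slideP (suc (sumDiag T)) T α 1

srAux : List Cell → List ℕ → Maybe (List Cell)
srAux acc []       = just acc
srAux acc (a ∷ as) with slideCell a acc
... | nothing = nothing
... | just d  = srAux (acc ++ [ d ]) as

R : List ℕ → Maybe (List Cell)
R α = srAux [] α

ShapeR : List ℕ → Cell → Set
ShapeR α x = ∃ λ cs → R α ≡ just cs × x ∈ cs

-- The tower diagram of a permutation w can be described directly: column c has height
-- #{u > c ∣ w⁻¹ u < w⁻¹ c}. Right multiplication by s_a at an ascent (w a < w (a + 1)) adds exactly the top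
-- cell of column w a, and sliding a into the diagram of w produces exactly that cell, while the slide
-- terminates at a descent. The corners of the diagram are the top cells of the columns w (a + 1) over the
-- descents a, and the flight number of such a corner is a. As the number of cells is the number of
-- inversions, a word is reduced iff each of its letters is an ascent when it is applied. Hence the SR
-- algorithm run on a reduced word records a standard tower tableau whose reading word is that word, and
-- conversely peeling off the last corner of a standard tower tableau of shape 𝒯_ω undoes the last letter
-- of its reading word.

module Submission where

open import Defs
open import Data.Nat using (ℕ; zero; suc; _+_; _∸_; _≤_; _<_; _≡ᵇ_; _<ᵇ_; z≤n; s≤s)
open import Data.Nat.Properties
open import Data.Bool using (Bool; true; false; if_then_else_; not; _∧_; _∨_)
open import Data.Bool.Properties using (∨-assoc; ∨-identityʳ; ∨-zeroʳ; ∧-zeroʳ; ∧-conicalˡ; ∧-conicalʳ; ∨-conicalˡ; ∨-conicalʳ; T-≡)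
open import Data.Product using (Σ; ∃; _×_; _,_; proj₁; proj₂)
open import Data.Sum using (_⊎_; inj₁; inj₂; [_,_]′)
open import Data.Empty using (⊥; ⊥-elim)
open import Data.Unit using (⊤; tt)
open import Data.Maybe using (Maybe; just; nothing; fromMaybe)
open import Data.Maybe.Properties using (just-injective)
open import Data.List using (List; []; _∷_; _++_; [_]; length; take; drop; lookup)
open import Data.List.Properties using (++-assoc; ++-identityʳ; ∷-injective; length-++)
open import Data.List.Reverse using (Reverse; []; _∶_∶ʳ_; reverseView)
open import Data.List.Relation.Unary.All using (All; []; _∷_)
import Data.List.Relation.Unary.All.Properties as AllP
open import Data.List.Relation.Unary.AllPairs using ([]; _∷_)
open import Data.List.Relation.Unary.Unique.Propositional using (Unique)
open import Data.List.Membership.Propositional using (_∈_; _∉_)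
open import Data.List.Relation.Unary.Any using (here; there)
open import Data.Fin using (Fin; toℕ) renaming (zero to fzero; suc to fsuc)
open import Relation.Binary.PropositionalEquality hiding ([_])
open import Relation.Nullary using (yes; no)
open import Relation.Binary.Definitions using (tri<; tri≈; tri>)
open import Function.Base using (_∘_; id)
open import Function.Bundles using (mk⇔; Equivalence; _⇔_)
open import Algebra.Properties.CommutativeSemigroup +-commutativeSemigroup using (interchange)

bool-ext : ∀ {a b : Bool} → (a ≡ true → b ≡ true) → (b ≡ true → a ≡ true) → a ≡ b
bool-ext {true} {true} p q = refl
bool-ext {true} {false} p q = sym (p refl)
bool-ext {false} {true} p q = q refl
bool-ext {false} {false} p q = refl

<ᵇ≡true : ∀ m n → m < n → (m <ᵇ n) ≡ true
<ᵇ≡true m n p = Equivalence.to T-≡ (<⇒<ᵇ p)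

<ᵇ≡true⁻¹ : ∀ m n → (m <ᵇ n) ≡ true → m < n
<ᵇ≡true⁻¹ m n p = <ᵇ⇒< m n (Equivalence.from T-≡ p)

<ᵇ≡false : ∀ m n → n ≤ m → (m <ᵇ n) ≡ false
<ᵇ≡false m n p with m <ᵇ n in eq
... | false = refl
... | true = ⊥-elim (<⇒≱ (<ᵇ≡true⁻¹ m n eq) p)

<ᵇ≡false⁻¹ : ∀ m n → (m <ᵇ n) ≡ false → n ≤ m
<ᵇ≡false⁻¹ m n p with m <? n
... | yes q with () ← trans (sym (<ᵇ≡true m n q)) p
... | no q = ≮⇒≥ q

≡ᵇ≡true : ∀ m n → m ≡ n → (m ≡ᵇ n) ≡ true
≡ᵇ≡true m n p = Equivalence.to T-≡ (≡⇒≡ᵇ m n p)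

≡ᵇ≡true⁻¹ : ∀ m n → (m ≡ᵇ n) ≡ true → m ≡ n
≡ᵇ≡true⁻¹ m n p = ≡ᵇ⇒≡ m n (Equivalence.from T-≡ p)

≡ᵇ≡false : ∀ m n → m ≢ n → (m ≡ᵇ n) ≡ false
≡ᵇ≡false m n p with m ≡ᵇ n in eq
... | false = refl
... | true = ⊥-elim (p (≡ᵇ≡true⁻¹ m n eq))

≡ᵇ≡false⁻¹ : ∀ m n → (m ≡ᵇ n) ≡ false → m ≢ n
≡ᵇ≡false⁻¹ m n p q with () ← trans (sym (≡ᵇ≡true m n q)) p

<ᵇ-skip : ∀ a n → n ≢ suc a → (a <ᵇ n) ≡ (suc a <ᵇ n)
<ᵇ-skip a n ne = bool-ext
  (λ p → <ᵇ≡true (suc a) n (≤∧≢⇒< (<ᵇ≡true⁻¹ a n p) (ne ∘ sym)))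
  (λ p → <ᵇ≡true a n (<-trans (n<1+n a) (<ᵇ≡true⁻¹ (suc a) n p)))

true≢false : true ≢ false
true≢false ()

∨-trueˡ : ∀ a b → a ≡ true → (a ∨ b) ≡ true
∨-trueˡ a b refl = refl

∨-trueʳ : ∀ a b → b ≡ true → (a ∨ b) ≡ true
∨-trueʳ a b refl = ∨-zeroʳ a

∨-true⁻¹ : ∀ a b → (a ∨ b) ≡ true → (a ≡ true) ⊎ (b ≡ true)
∨-true⁻¹ true b _ = inj₁ refl
∨-true⁻¹ false b p = inj₂ p

∧-true : ∀ a b → a ≡ true → b ≡ true → (a ∧ b) ≡ true
∧-true a b refl refl = refl

∧-falseʳ : ∀ a b → b ≡ false → (a ∧ b) ≡ false
∧-falseʳ a b refl = ∧-zeroʳ a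

ind : Bool → ℕ
ind true = 1
ind false = 0

count : ℕ → (ℕ → Bool) → ℕ
count zero P = 0
count (suc n) P = ind (P n) + count n P

ind≤1 : ∀ b → ind b ≤ 1
ind≤1 true = s≤s z≤n
ind≤1 false = z≤n

count-cong : ∀ n {P Q : ℕ → Bool} → (∀ u → u < n → P u ≡ Q u) → count n P ≡ count n Q
count-cong zero h = refl
count-cong (suc n) h = cong₂ _+_ (cong ind (h n ≤-refl)) (count-cong n (λ u p → h u (m≤n⇒m≤1+n p)))

ind-mono : ∀ {a b} → (a ≡ true → b ≡ true) → ind a ≤ ind b
ind-mono {false} h = z≤n
ind-mono {true} h rewrite h refl = ≤-refl

count-mono : ∀ n {P Q : ℕ → Bool} → (∀ u → u < n → P u ≡ true → Q u ≡ true) → count n P ≤ count n Q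
count-mono zero h = z≤n
count-mono (suc n) h = +-mono-≤ (ind-mono (h n ≤-refl)) (count-mono n (λ u p → h u (m≤n⇒m≤1+n p)))

ind-∨ : ∀ a b → ind (a ∨ b) ≤ ind a + ind b
ind-∨ true b = s≤s z≤n
ind-∨ false b = ≤-refl

count-∨ : ∀ n P Q → count n (λ u → P u ∨ Q u) ≤ count n P + count n Q
count-∨ zero P Q = z≤n
count-∨ (suc n) P Q =
  ≤-trans (+-mono-≤ (ind-∨ (P n) (Q n)) (count-∨ n P Q))
          (≤-reflexive (interchange (ind (P n)) (ind (Q n)) (count n P) (count n Q)))

count-≤-∨ : ∀ n (P Q S : ℕ → Bool) → (∀ u → u < n → P u ≡ true → (Q u ∨ S u) ≡ true) → count n P ≤ count n Q + count n S
count-≤-∨ n P Q S h = ≤-trans (count-mono n h) (count-∨ n Q S)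

count-all : ∀ n (P : ℕ → Bool) → (∀ u → u < n → P u ≡ true) → count n P ≡ n
count-all zero P h = refl
count-all (suc n) P h rewrite h n ≤-refl = cong suc (count-all n P (λ u p → h u (m≤n⇒m≤1+n p)))

count-none : ∀ n (P : ℕ → Bool) → (∀ u → u < n → P u ≡ false) → count n P ≡ 0
count-none zero P h = refl
count-none (suc n) P h rewrite h n ≤-refl = count-none n P (λ u p → h u (m≤n⇒m≤1+n p))

count-gap : ∀ m n (P : ℕ → Bool) → m ≤ n → (∀ u → m ≤ u → u < n → P u ≡ false) → count n P ≡ count m P
count-gap m zero P z≤n h = refl
count-gap m (suc n) P le h with m ≟ suc n
... | yes refl = refl
... | no ne rewrite h n (≤-pred (≤∧≢⇒< le ne)) ≤-refl = count-gap m n P (≤-pred (≤∧≢⇒< le ne)) (λ u p q → h u p (m≤n⇒m≤1+n q))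

count-mono-bound : ∀ m n (P : ℕ → Bool) → m ≤ n → count m P ≤ count n P
count-mono-bound m zero P z≤n = ≤-refl
count-mono-bound m (suc n) P le with m ≟ suc n
... | yes refl = ≤-refl
... | no ne = ≤-trans (count-mono-bound m n P (≤-pred (≤∧≢⇒< le ne))) (m≤n+m _ _)

count-bump : ∀ n x (P Q : ℕ → Bool) → x < n → (∀ u → u ≢ x → P u ≡ Q u) → P x ≡ false → Q x ≡ true →
  count n Q ≡ suc (count n P)
count-bump zero x P Q () h px qx
count-bump (suc n) x P Q lt h px qx with n ≟ x
... | yes refl rewrite px | qx = cong suc (count-cong n (λ u un → sym (h u (λ e → <-irrefl e un))))
... | no ne rewrite h n ne =
  trans (cong (ind (Q n) +_) (count-bump n x P Q (≤∧≢⇒< (≤-pred lt) (ne ∘ sym)) h px qx)) (+-suc (ind (Q n)) _)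

count-false-at-0 : ∀ n P → P 0 ≡ false → count n P ≤ n ∸ 1
count-false-at-0 zero P p = z≤n
count-false-at-0 (suc zero) P p rewrite p = z≤n
count-false-at-0 (suc (suc n)) P p =
  ≤-trans (+-monoʳ-≤ (ind (P (suc n))) (count-false-at-0 (suc n) P p)) (+-monoˡ-≤ n (ind≤1 (P (suc n))))

largest : ∀ n (P : ℕ → Bool) →
  (∀ u → u < n → P u ≡ false) ⊎ (Σ ℕ λ u → u < n × P u ≡ true × (∀ v → u < v → v < n → P v ≡ false))
largest zero P = inj₁ (λ u ())
largest (suc n) P with P n in eq
... | true = inj₂ (n , ≤-refl , eq , λ v p q → ⊥-elim (<⇒≱ p (≤-pred q)))
... | false with largest n P
... | inj₁ h = inj₁ (λ u p → case u (m≤n⇒m<n∨m≡n (≤-pred p))) where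
  case : ∀ u → (u < n) ⊎ (u ≡ n) → P u ≡ false
  case u (inj₁ x) = h u x
  case u (inj₂ refl) = eq
... | inj₂ (u , p , q , r) = inj₂ (u , m≤n⇒m≤1+n p , q , λ v a b → case v a (m≤n⇒m<n∨m≡n (≤-pred b))) where
  case : ∀ v → u < v → (v < n) ⊎ (v ≡ n) → P v ≡ false
  case v a (inj₁ x) = r v a x
  case v a (inj₂ refl) = eq

record SmallestFrom (m n : ℕ) (P : ℕ → Bool) : Set where
  field
    least     : ℕ
    from≤     : m ≤ least
    ≤bound    : least ≤ n
    holds     : P least ≡ true
    minimal   : ∀ v → m ≤ v → v < least → P v ≡ false

smallest : ∀ k m (P : ℕ → Bool) → P (k + m) ≡ true → SmallestFrom m (k + m) P
smallest k m P h with P m in eq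
... | true = record { least = m ; from≤ = ≤-refl ; ≤bound = m≤n+m m k ; holds = eq ; minimal = λ v p q → ⊥-elim (<⇒≱ q p) }
smallest zero m P h | false with () ← trans (sym h) eq
smallest (suc k) m P h | false with smallest k (suc m) P (trans (cong P (+-suc k m)) h)
... | record { least = i ; from≤ = p ; ≤bound = q ; holds = r ; minimal = s } = record
  { least = i ; from≤ = <⇒≤ p ; ≤bound = ≤-trans q (≤-reflexive (+-suc k m)) ; holds = r ; minimal = case }
  where
  case : ∀ v → m ≤ v → v < i → P v ≡ false
  case v a b with m ≟ v
  ... | yes refl = eq
  ... | no ne = s v (≤∧≢⇒< a ne) b

module Pigeonhole (g : ℕ → ℕ) (g-injective : ∀ {u v} → g u ≡ g v → u ≡ v) where

  count-≡-≤1 : ∀ n t → count n (λ u → g u ≡ᵇ t) ≤ 1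
  count-≡-≤1 zero t = z≤n
  count-≡-≤1 (suc n) t with g n ≡ᵇ t in eq
  ... | false = count-≡-≤1 n t
  ... | true = ≤-reflexive (cong suc (count-none n _ λ u p → ≡ᵇ≡false (g u) t λ q → <-irrefl (g-injective (trans q (sym (≡ᵇ≡true⁻¹ _ _ eq)))) p))

  count-<-≤ : ∀ n hi → count n (λ u → g u <ᵇ hi) ≤ hi
  count-<-≤ n zero = ≤-reflexive (count-none n _ λ u _ → <ᵇ≡false (g u) 0 z≤n)
  count-<-≤ n (suc h) = begin
      count n (λ u → g u <ᵇ suc h)
    ≤⟨ count-≤-∨ n _ (λ u → g u <ᵇ h) (λ u → g u ≡ᵇ h) pt ⟩
      count n (λ u → g u <ᵇ h) + count n (λ u → g u ≡ᵇ h)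
    ≤⟨ +-mono-≤ (count-<-≤ n h) (count-≡-≤1 n h) ⟩
      h + 1
    ≡⟨ +-comm h 1 ⟩
      suc h ∎
    where
    open ≤-Reasoning
    pt : ∀ u → u < n → (g u <ᵇ suc h) ≡ true → ((g u <ᵇ h) ∨ (g u ≡ᵇ h)) ≡ true
    pt u _ p with m≤n⇒m<n∨m≡n (≤-pred (<ᵇ≡true⁻¹ (g u) (suc h) p))
    ... | inj₁ q = ∨-trueˡ _ _ (<ᵇ≡true _ _ q)
    ... | inj₂ q = ∨-trueʳ (g u <ᵇ h) _ (≡ᵇ≡true (g u) h q)

  count-between-≤ : ∀ n lo hi → count n (λ u → (lo <ᵇ g u) ∧ (g u <ᵇ hi)) ≤ hi ∸ suc lo
  count-between-≤ n lo zero = ≤-reflexive (count-none n _ λ u _ → ∧-falseʳ (lo <ᵇ g u) _ (<ᵇ≡false (g u) 0 z≤n))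
  count-between-≤ n lo (suc h) with lo <? h
  ... | no q = ≤-trans (≤-reflexive (count-none n _ λ u _ → pt u)) z≤n where
    pt : ∀ u → ((lo <ᵇ g u) ∧ (g u <ᵇ suc h)) ≡ false
    pt u with lo <ᵇ g u in e1
    ... | false = refl
    ... | true = <ᵇ≡false (g u) (suc h) (≤-trans (s≤s (≮⇒≥ q)) (<ᵇ≡true⁻¹ _ _ e1))
  ... | yes q = begin
      count n (λ u → (lo <ᵇ g u) ∧ (g u <ᵇ suc h))
    ≤⟨ count-≤-∨ n _ (λ u → (lo <ᵇ g u) ∧ (g u <ᵇ h)) (λ u → g u ≡ᵇ h) pt ⟩
      count n (λ u → (lo <ᵇ g u) ∧ (g u <ᵇ h)) + count n (λ u → g u ≡ᵇ h)
    ≤⟨ +-mono-≤ (count-between-≤ n lo h) (count-≡-≤1 n h) ⟩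
      (h ∸ suc lo) + 1
    ≡⟨ +-comm (h ∸ suc lo) 1 ⟩
      suc (h ∸ suc lo)
    ≡⟨ sym (+-∸-assoc 1 q) ⟩
      suc h ∸ suc lo ∎
    where
    open ≤-Reasoning
    pt : ∀ u → u < n → ((lo <ᵇ g u) ∧ (g u <ᵇ suc h)) ≡ true → (((lo <ᵇ g u) ∧ (g u <ᵇ h)) ∨ (g u ≡ᵇ h)) ≡ true
    pt u _ p with m≤n⇒m<n∨m≡n (≤-pred (<ᵇ≡true⁻¹ (g u) (suc h) (∧-conicalʳ (lo <ᵇ g u) _ p)))
    ... | inj₁ r = ∨-trueˡ _ _ (∧-true (lo <ᵇ g u) _ (∧-conicalˡ (lo <ᵇ g u) (g u <ᵇ suc h) p) (<ᵇ≡true _ _ r))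
    ... | inj₂ r = ∨-trueʳ ((lo <ᵇ g u) ∧ (g u <ᵇ h)) _ (≡ᵇ≡true (g u) h r)

-- Transpositions and permutations

s-at : ∀ a → s a a ≡ suc a
s-at a rewrite ≡ᵇ≡true a a refl = refl

s-at-suc : ∀ a → s a (suc a) ≡ a
s-at-suc a rewrite ≡ᵇ≡false (suc a) a 1+n≢n | ≡ᵇ≡true (suc a) (suc a) refl = refl

s-other : ∀ a n → n ≢ a → n ≢ suc a → s a n ≡ n
s-other a n p q rewrite ≡ᵇ≡false n a p | ≡ᵇ≡false n (suc a) q = refl

data SView (a n : ℕ) : Set where
  isA : n ≡ a → SView a n
  isSA : n ≡ suc a → SView a n
  isO : n ≢ a → n ≢ suc a → SView a n

sview : ∀ a n → SView a n
sview a n with n ≟ a | n ≟ suc a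
... | yes p | _ = isA p
... | no p | yes q = isSA q
... | no p | no q = isO p q

s-involutive : ∀ a n → s a (s a n) ≡ n
s-involutive a n with sview a n
... | isA refl rewrite s-at n = s-at-suc n
... | isSA refl rewrite s-at-suc a = s-at a
... | isO p q rewrite s-other a n p q = s-other a n p q

s-fix0 : ∀ a → 1 ≤ a → s a 0 ≡ 0
s-fix0 a p = s-other a 0 (<⇒≢ p) (λ ())

record Perm : Set where
  field
    f g : ℕ → ℕ
    fg : ∀ n → f (g n) ≡ n
    gf : ∀ n → g (f n) ≡ n
    f0 : f 0 ≡ 0
open Perm public

module _ (w : Perm) where
  f-injective : ∀ {u v} → f w u ≡ f w v → u ≡ v
  f-injective {u} {v} p = trans (sym (gf w u)) (trans (cong (g w) p) (gf w v))

  g-injective : ∀ {u v} → g w u ≡ g w v → u ≡ v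
  g-injective {u} {v} p = trans (sym (fg w u)) (trans (cong (f w) p) (fg w v))

  g-fix0 : g w 0 ≡ 0
  g-fix0 = trans (cong (g w) (sym (f0 w))) (gf w 0)

  f-pos : ∀ {u} → 1 ≤ u → 1 ≤ f w u
  f-pos {u} p with f w u in eq
  ... | zero = ⊥-elim (<⇒≢ p (sym (f-injective (trans eq (sym (f0 w))))))
  ... | suc _ = s≤s z≤n

  g-pos : ∀ {u} → 1 ≤ u → 1 ≤ g w u
  g-pos {u} p with g w u in eq
  ... | zero = ⊥-elim (<⇒≢ p (sym (g-injective (trans eq (sym g-fix0)))))
  ... | suc _ = s≤s z≤n

  g≡⇒≡f : ∀ {u a} → g w u ≡ a → u ≡ f w a
  g≡⇒≡f {u} refl = sym (fg w u)

  inversionsLeft : ℕ → ℕ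
  inversionsLeft c = count c (λ u → g w c <ᵇ g w u)

  top : ℕ → ℕ
  top c = g w c + inversionsLeft c

  countAbove : ℕ → ℕ → ℕ
  countAbove a c = count c (λ u → suc a <ᵇ g w u)

  -- The tower diagram of w: column c ≥ 1 holds the cells (c , k) with c + k < top c, so its height is
  -- top c ∸ c = #{u > c ∣ g u < g c}.
  inTower : Cell → Bool
  inTower (c , k) = (0 <ᵇ c) ∧ (c + k <ᵇ top c)

  open Pigeonhole (g w) g-injective

  inversionsLeft-≤ : ∀ v b → g w v ≤ b → inversionsLeft v ≤ (b ∸ g w v) + count v (λ u → b <ᵇ g w u)
  inversionsLeft-≤ v b le =
    ≤-trans (count-≤-∨ v _ (λ u → (g w v <ᵇ g w u) ∧ (g w u <ᵇ suc b)) (λ u → b <ᵇ g w u) pt)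
            (+-monoˡ-≤ _ (count-between-≤ v (g w v) (suc b)))
    where
    pt : ∀ u → u < v → (g w v <ᵇ g w u) ≡ true → (((g w v <ᵇ g w u) ∧ (g w u <ᵇ suc b)) ∨ (b <ᵇ g w u)) ≡ true
    pt u _ p with g w u ≤? b
    ... | yes q = ∨-trueˡ _ _ (∧-true _ _ p (<ᵇ≡true _ _ (s≤s q)))
    ... | no q = ∨-trueʳ ((g w v <ᵇ g w u) ∧ (g w u <ᵇ suc b)) _ (<ᵇ≡true _ _ (≰⇒> q))

  countAbove-≤ : ∀ v a → countAbove a v ≤ (g w v ∸ suc (suc a)) + inversionsLeft v
  countAbove-≤ v a =
    ≤-trans (count-≤-∨ v _ (λ u → (suc a <ᵇ g w u) ∧ (g w u <ᵇ g w v)) (λ u → g w v <ᵇ g w u) pt)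
            (+-monoˡ-≤ _ (count-between-≤ v (suc a) (g w v)))
    where
    pt : ∀ u → u < v → (suc a <ᵇ g w u) ≡ true → (((suc a <ᵇ g w u) ∧ (g w u <ᵇ g w v)) ∨ (g w v <ᵇ g w u)) ≡ true
    pt u uv p with <-cmp (g w u) (g w v)
    ... | tri< q _ _ = ∨-trueˡ _ _ (∧-true _ _ p (<ᵇ≡true _ _ q))
    ... | tri≈ _ q _ = ⊥-elim (<⇒≢ uv (g-injective q))
    ... | tri> _ _ q = ∨-trueʳ ((suc a <ᵇ g w u) ∧ (g w u <ᵇ g w v)) _ (<ᵇ≡true _ _ q)

  ≤-countAbove : ∀ v a → (∀ u → u < v → g w u ≢ a) → (∀ u → u < v → g w u ≢ suc a) → v ≤ a + countAbove a v
  ≤-countAbove v a h1 h2 = begin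
      v
    ≡⟨ sym (count-all v (λ _ → true) (λ _ _ → refl)) ⟩
      count v (λ _ → true)
    ≤⟨ count-≤-∨ v _ (λ u → g w u <ᵇ a) (λ u → suc a <ᵇ g w u) pt ⟩
      count v (λ u → g w u <ᵇ a) + countAbove a v
    ≤⟨ +-monoˡ-≤ _ (count-<-≤ v a) ⟩
      a + countAbove a v ∎
    where
    open ≤-Reasoning
    pt : ∀ u → u < v → true ≡ true → ((g w u <ᵇ a) ∨ (suc a <ᵇ g w u)) ≡ true
    pt u uv _ with <-cmp (g w u) a
    ... | tri< q _ _ = ∨-trueˡ _ _ (<ᵇ≡true _ _ q)
    ... | tri≈ _ q _ = ⊥-elim (h1 u uv q)
    ... | tri> _ _ q with m≤n⇒m<n∨m≡n q
    ... | inj₁ r = ∨-trueʳ (g w u <ᵇ a) _ (<ᵇ≡true _ _ r)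
    ... | inj₂ r = ⊥-elim (h2 u uv (sym r))

  ≤-top : ∀ c → c ≤ top c
  ≤-top c = begin
      c
    ≡⟨ sym (count-all c (λ _ → true) (λ _ _ → refl)) ⟩
      count c (λ _ → true)
    ≤⟨ count-≤-∨ c _ (λ u → g w u <ᵇ g w c) (λ u → g w c <ᵇ g w u) pt ⟩
      count c (λ u → g w u <ᵇ g w c) + inversionsLeft c
    ≤⟨ +-monoˡ-≤ _ (count-<-≤ c (g w c)) ⟩
      top c ∎
    where
    open ≤-Reasoning
    pt : ∀ u → u < c → true ≡ true → ((g w u <ᵇ g w c) ∨ (g w c <ᵇ g w u)) ≡ true
    pt u uc _ with <-cmp (g w u) (g w c)
    ... | tri< q _ _ = ∨-trueˡ _ _ (<ᵇ≡true _ _ q)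
    ... | tri≈ _ q _ = ⊥-elim (<⇒≢ uc (g-injective q))
    ... | tri> _ _ q = ∨-trueʳ (g w u <ᵇ g w c) _ (<ᵇ≡true _ _ q)

  top-≤ : ∀ v a → g w v ≤ a → (∀ u → u < v → g w u ≢ suc a) → top v ≤ a + countAbove a v
  top-≤ v a le h = begin
      g w v + inversionsLeft v
    ≤⟨ +-monoʳ-≤ (g w v) (inversionsLeft-≤ v a le) ⟩
      g w v + ((a ∸ g w v) + count v (λ u → a <ᵇ g w u))
    ≡⟨ sym (+-assoc (g w v) _ _) ⟩
      (g w v + (a ∸ g w v)) + count v (λ u → a <ᵇ g w u)
    ≡⟨ cong₂ _+_ (m+[n∸m]≡n le) (count-cong v (λ u uv → <ᵇ-skip a (g w u) (h u uv))) ⟩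
      a + countAbove a v ∎
    where open ≤-Reasoning

  top-< : ∀ v a → g w v < a → (∀ u → u < v → g w u ≢ a) → (∀ u → u < v → g w u ≢ suc a) → suc (top v) ≤ a + countAbove a v
  top-< v (suc a') lt h1 h2 = begin
      suc (g w v + inversionsLeft v)
    ≤⟨ s≤s (+-monoʳ-≤ (g w v) (inversionsLeft-≤ v a' (≤-pred lt))) ⟩
      suc (g w v + ((a' ∸ g w v) + count v (λ u → a' <ᵇ g w u)))
    ≡⟨ cong suc (sym (+-assoc (g w v) _ _)) ⟩
      suc ((g w v + (a' ∸ g w v)) + count v (λ u → a' <ᵇ g w u))
    ≡⟨ cong suc (cong₂ _+_ (m+[n∸m]≡n (≤-pred lt)) (count-cong v skip2)) ⟩
      suc a' + countAbove (suc a') v ∎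
    where
    open ≤-Reasoning
    skip2 : ∀ u → u < v → (a' <ᵇ g w u) ≡ (suc (suc a') <ᵇ g w u)
    skip2 u uv = trans (<ᵇ-skip a' (g w u) (h1 u uv)) (<ᵇ-skip (suc a') (g w u) (h2 u uv))

  top-≥ : ∀ v a → suc a < g w v → suc (suc (a + countAbove a v)) ≤ top v
  top-≥ v a lt = begin
      suc (suc a) + countAbove a v
    ≤⟨ +-monoʳ-≤ (suc (suc a)) (countAbove-≤ v a) ⟩
      suc (suc a) + ((g w v ∸ suc (suc a)) + inversionsLeft v)
    ≡⟨ sym (+-assoc (suc (suc a)) _ _) ⟩
      (suc (suc a) + (g w v ∸ suc (suc a))) + inversionsLeft v
    ≡⟨ cong (_+ inversionsLeft v) (m+[n∸m]≡n lt) ⟩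
      top v ∎
    where open ≤-Reasoning

  top-≡-at : ∀ x a → g w x ≡ a → (∀ u → u < x → g w u ≢ suc a) → top x ≡ a + countAbove a x
  top-≡-at x a eq h =
    trans (cong (_+ inversionsLeft x) eq)
          (cong (a +_) (trans (count-cong x (λ u ux → cong (_<ᵇ g w u) eq))
                              (count-cong x (λ u ux → <ᵇ-skip a (g w u) (h u ux)))))

  top-≡-at-suc : ∀ y a → g w y ≡ suc a → top y ≡ suc (a + countAbove a y)
  top-≡-at-suc y a eq rewrite eq = refl

module Letter (w : Perm) (a : ℕ) where
  x y : ℕ
  x = f w a
  y = f w (suc a)
  gx : g w x ≡ a
  gx = gf w a
  gy : g w y ≡ suc a
  gy = gf w (suc a)
  ga : ∀ u → u ≢ x → g w u ≢ a
  ga u ne p = ne (g≡⇒≡f w p)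
  gsa : ∀ u → u ≢ y → g w u ≢ suc a
  gsa u ne p = ne (g≡⇒≡f w p)
  x≢y : x ≢ y
  x≢y e = 1+n≢n (sym (f-injective w e))
  y-pos : 1 ≤ y
  y-pos = f-pos w (s≤s z≤n)

==c-true : ∀ a b c d → a ≡ c → b ≡ d → ((a , b) ==c (c , d)) ≡ true
==c-true a b c d p q rewrite ≡ᵇ≡true a c p | ≡ᵇ≡true b d q = refl

==c-true⁻¹ : ∀ a b c d → ((a , b) ==c (c , d)) ≡ true → (a , b) ≡ (c , d)
==c-true⁻¹ a b c d p = cong₂ _,_ (≡ᵇ≡true⁻¹ a c (∧-conicalˡ (a ≡ᵇ c) _ p)) (≡ᵇ≡true⁻¹ b d (∧-conicalʳ (a ≡ᵇ c) _ p))

==c-refl : ∀ z → (z ==c z) ≡ true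
==c-refl (a , b) = ==c-true a b a b refl refl

memb⇒∈ : ∀ x T → memb x T ≡ true → x ∈ T
memb⇒∈ x (y ∷ T) p with ∨-true⁻¹ (x ==c y) (memb x T) p
... | inj₁ q = here (==c-true⁻¹ _ _ _ _ q)
... | inj₂ q = there (memb⇒∈ x T q)

∈⇒memb : ∀ x T → x ∈ T → memb x T ≡ true
∈⇒memb x (y ∷ T) (here refl) = ∨-trueˡ (x ==c x) _ (==c-refl x)
∈⇒memb x (y ∷ T) (there p) = ∨-trueʳ (x ==c y) _ (∈⇒memb x T p)

memb-false⇒∉ : ∀ x T → memb x T ≡ false → x ∉ T
memb-false⇒∉ x T p q = true≢false (trans (sym (∈⇒memb x T q)) p)

memb-++ : ∀ x T c → memb x (T ++ [ c ]) ≡ (memb x T ∨ (x ==c c))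
memb-++ x [] c = ∨-identityʳ (x ==c c)
memb-++ x (y ∷ T) c rewrite memb-++ x T c = sym (∨-assoc (x ==c y) _ _)

memb⇒≤sumDiag : ∀ c k T → memb (c , k) T ≡ true → c + k ≤ sumDiag T
memb⇒≤sumDiag c k ((y1 , y2) ∷ T) p with ∨-true⁻¹ ((c , k) ==c (y1 , y2)) (memb (c , k) T) p
... | inj₁ q with ==c-true⁻¹ c k y1 y2 q
... | refl = m≤m+n (c + k) (sumDiag T)
memb⇒≤sumDiag c k ((y1 , y2) ∷ T) p | inj₂ q = ≤-trans (memb⇒≤sumDiag c k T q) (m≤n+m _ (y1 + y2))

record TowerOf (T : List Cell) (w : Perm) : Set where
  constructor towerOf
  field memb≡inTower : ∀ z → memb z T ≡ inTower w z
open TowerOf public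

tower-memb : ∀ {T w} → TowerOf T w → ∀ c k → 1 ≤ c → c + k < top w c → memb (c , k) T ≡ true
tower-memb rep c k c1 lt = trans (memb≡inTower rep (c , k)) (∧-true (0 <ᵇ c) _ (<ᵇ≡true 0 c c1) (<ᵇ≡true _ _ lt))

tower-non-memb : ∀ {T w} → TowerOf T w → ∀ c k → top w c ≤ c + k → memb (c , k) T ≡ false
tower-non-memb rep c k le = trans (memb≡inTower rep (c , k)) (∧-falseʳ (0 <ᵇ c) _ (<ᵇ≡false _ _ le))

tower-memb⁻¹ : ∀ {T w} → TowerOf T w → ∀ c k → memb (c , k) T ≡ true → c + k < top w c
tower-memb⁻¹ rep c k p = <ᵇ≡true⁻¹ _ _ (∧-conicalʳ (0 <ᵇ c) _ (trans (sym (memb≡inTower rep (c , k))) p))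

tower-col-pos : ∀ {T w} → TowerOf T w → ∀ c k → memb (c , k) T ≡ true → 1 ≤ c
tower-col-pos rep c k p = <ᵇ≡true⁻¹ 0 c (∧-conicalˡ (0 <ᵇ c) _ (trans (sym (memb≡inTower rep (c , k))) p))

mulS : (w : Perm) (a : ℕ) → 1 ≤ a → Perm
mulS w a a1 = record
  { f = λ n → f w (s a n)
  ; g = λ n → s a (g w n)
  ; fg = λ n → trans (cong (f w) (s-involutive a (g w n))) (fg w n)
  ; gf = λ n → trans (cong (s a) (gf w (s a n))) (s-involutive a n)
  ; f0 = trans (cong (f w) (s-fix0 a a1)) (f0 w)
  }

<ᵇ-s-other : ∀ a p t → p ≢ a → p ≢ suc a → (p <ᵇ s a t) ≡ (p <ᵇ t)
<ᵇ-s-other a p t h1 h2 with sview a t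
... | isA refl rewrite s-at t = bool-ext (λ q → <ᵇ≡true p t (lem (<ᵇ≡true⁻¹ p (suc t) q))) (λ q → <ᵇ≡true p (suc t) (m≤n⇒m≤1+n (<ᵇ≡true⁻¹ p t q)))
  where lem : p < suc t → p < t
        lem q = ≤∧≢⇒< (≤-pred q) h1
... | isSA refl rewrite s-at-suc a =
  bool-ext (λ q → <ᵇ≡true p (suc a) (m≤n⇒m≤1+n (<ᵇ≡true⁻¹ p a q)))
           (λ q → <ᵇ≡true p a (≤∧≢⇒< (≤-pred (<ᵇ≡true⁻¹ p (suc a) q)) h1))
... | isO h3 h4 rewrite s-other a t h3 h4 = refl

module AscentStep (w : Perm) (a : ℕ) (a1 : 1 ≤ a) (asc : f w a < f w (suc a)) where
  w' = mulS w a a1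
  open Letter w a

  top-mulS : ∀ c → top w' c ≡ top w c + ind (c ≡ᵇ x)
  top-mulS c with sview a (g w c)
  ... | isA p rewrite g≡⇒≡f w p | ≡ᵇ≡true x x refl | gx | s-at a =
    trans (cong (λ z → suc (a + z)) (count-cong x pt)) (+-comm 1 _)
    where
    pt : ∀ u → u < x → (suc a <ᵇ s a (g w u)) ≡ (a <ᵇ g w u)
    pt u ux with g w u ≟ a | g w u ≟ suc a
    ... | yes e | _ = ⊥-elim (<⇒≢ ux (g≡⇒≡f w e))
    ... | no _ | yes e = ⊥-elim (<⇒≢ (<-trans ux asc) (g≡⇒≡f w e))
    ... | no e1 | no e2 rewrite s-other a (g w u) e1 e2 = sym (<ᵇ-skip a (g w u) e2)
  ... | isSA p rewrite g≡⇒≡f w p | ≡ᵇ≡false y x (λ e → <⇒≢ asc (sym e)) | gy | s-at-suc a =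
    trans (cong (a +_) bump) (trans (+-suc a _) (sym (+-identityʳ _)))
    where
    P Q : ℕ → Bool
    P u = suc a <ᵇ g w u
    Q u = a <ᵇ s a (g w u)
    agree-off-x : ∀ u → u ≢ x → P u ≡ Q u
    agree-off-x u ne with sview a (g w u)
    ... | isA e = ⊥-elim (ga u ne e)
    ... | isSA e rewrite e | s-at-suc a = trans (<ᵇ≡false (suc a) (suc a) ≤-refl) (sym (<ᵇ≡false a a ≤-refl))
    ... | isO e1 e2 rewrite s-other a (g w u) e1 e2 = sym (<ᵇ-skip a (g w u) e2)
    bump : count y Q ≡ suc (count y P)
    bump = count-bump y x P Q asc agree-off-x (trans (cong (suc a <ᵇ_) gx) (<ᵇ≡false (suc a) a (n≤1+n a)))
                      (trans (cong (λ z → a <ᵇ s a z) gx) (trans (cong (a <ᵇ_) (s-at a)) (<ᵇ≡true a (suc a) ≤-refl)))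
  ... | isO p1 p2 rewrite s-other a (g w c) p1 p2 | ≡ᵇ≡false c x (λ e → p1 (trans (cong (g w) e) gx)) =
    trans (cong (g w c +_) (count-cong c (λ u _ → <ᵇ-s-other a (g w c) (g w u) p1 p2))) (sym (+-identityʳ _))

  x1 : 1 ≤ x
  x1 = f-pos w a1

  inTower-mulS : ∀ z → inTower w' z ≡ (inTower w z ∨ (z ==c (x , top w x ∸ x)))
  inTower-mulS (c , k) with c ≟ x
  ... | no ne rewrite top-mulS c | ≡ᵇ≡false c x ne | +-identityʳ (top w c) = sym (∨-identityʳ _)
  ... | yes refl rewrite top-mulS x | ≡ᵇ≡true x x refl | <ᵇ≡true 0 x x1 =
    bool-ext (λ q → fwd (<ᵇ≡true⁻¹ (x + k) (top w x + 1) q)) bwd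
    where
    x≤top : x ≤ top w x
    x≤top = ≤-top w x
    fwd : x + k < top w x + 1 → ((x + k <ᵇ top w x) ∨ (k ≡ᵇ top w x ∸ x)) ≡ true
    fwd lt with m≤n⇒m<n∨m≡n (≤-pred (≤-trans lt (≤-reflexive (+-comm (top w x) 1))))
    ... | inj₁ q = ∨-trueˡ _ _ (<ᵇ≡true _ _ q)
    ... | inj₂ q = ∨-trueʳ (x + k <ᵇ top w x) _ (≡ᵇ≡true k (top w x ∸ x) (trans (sym (m+n∸m≡n x k)) (cong (_∸ x) q)))
    bwd : ((x + k <ᵇ top w x) ∨ (k ≡ᵇ top w x ∸ x)) ≡ true → (x + k <ᵇ top w x + 1) ≡ true
    bwd q with ∨-true⁻¹ (x + k <ᵇ top w x) _ q
    ... | inj₁ r = <ᵇ≡true _ _ (≤-trans (<ᵇ≡true⁻¹ _ _ r) (m≤m+n (top w x) 1))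
    ... | inj₂ r = <ᵇ≡true _ _ (≤-reflexive (trans (cong (λ z → suc (x + z)) (≡ᵇ≡true⁻¹ k _ r)) (trans (cong suc (m+[n∸m]≡n x≤top)) (+-comm 1 (top w x)))))

  TowerOf-mulS : ∀ T → TowerOf T w → TowerOf (T ++ [ (x , top w x ∸ x) ]) w'
  TowerOf-mulS T rep = towerOf λ z → trans (memb-++ z T _) (trans (cong (_∨ (z ==c (x , top w x ∸ x))) (memb≡inTower rep z)) (sym (inTower-mulS z)))

-- Sliding

findSmallest-nothing : ∀ T d n i → (∀ v → i ≤ v → v < i + n → memb (v , d ∸ v) T ≡ false) → findSmallest T d i n ≡ nothing
findSmallest-nothing T d zero i h = refl
findSmallest-nothing T d (suc n) i h rewrite h i ≤-refl (≤-trans (s≤s (m≤m+n i n)) (≤-reflexive (sym (+-suc i n)))) =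
  findSmallest-nothing T d n (suc i) λ v p q → h v (<⇒≤ p) (≤-trans q (≤-reflexive (sym (+-suc i n))))

findSmallest-just : ∀ T d n i k → i ≤ k → k < i + n → (∀ v → i ≤ v → v < k → memb (v , d ∸ v) T ≡ false) →
  memb (k , d ∸ k) T ≡ true → findSmallest T d i n ≡ just k
findSmallest-just T d zero i k ik lt h hk = ⊥-elim (<⇒≱ lt (≤-trans (≤-reflexive (+-identityʳ i)) ik))
findSmallest-just T d (suc n) i k ik lt h hk with i ≟ k
... | yes refl rewrite hk = refl
... | no ne rewrite h i ≤-refl (≤∧≢⇒< ik ne) =
  findSmallest-just T d n (suc i) k (≤∧≢⇒< ik ne) (≤-trans lt (≤-reflexive (+-suc i n))) (λ v p q → h v (<⇒≤ p) q) hk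

slideBranch : ℕ → List Cell → ℕ → ℕ → Maybe Cell
slideBranch fu T γ i =
  if not (memb (i , γ ∸ i) T) then just (i , γ ∸ i)
  else (if not (memb (i , suc (γ ∸ i)) T) then nothing else slideP fu T (suc γ) (suc i))

slideP-hit : ∀ fu T γ m i → findSmallest T (γ ∸ 1) m (γ ∸ m) ≡ just i → slideP (suc fu) T γ m ≡ slideBranch fu T γ i
slideP-hit fu T γ m i e rewrite e = refl

slideP-no-hit : ∀ fu T γ m → findSmallest T (γ ∸ 1) m (γ ∸ m) ≡ nothing → slideP (suc fu) T γ m ≡ slideBranch fu T γ γ
slideP-no-hit fu T γ m e rewrite e | n∸n≡0 γ = refl

module Slide (w : Perm) (a : ℕ) (a1 : 1 ≤ a) (T : List Cell) (rep : TowerOf T w) where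
  open Letter w a
  x1 : 1 ≤ x
  x1 = f-pos w a1

  result : Maybe Cell
  result = if x <ᵇ y then just (x , top w x ∸ x) else nothing

  -- the columns that can stop the slide on the current diagonal
  Hit : ℕ → Bool
  Hit v = (suc a <ᵇ g w v) ∨ ((v ≡ᵇ x) ∨ (v ≡ᵇ y))

  Branch : ℕ → ℕ → ℕ → Maybe Cell
  Branch fu γ i = slideBranch fu T γ i

  Branch-continue : ∀ fu γ i → memb (i , γ ∸ i) T ≡ true → memb (i , suc (γ ∸ i)) T ≡ true →
    Branch fu γ i ≡ slideP fu T (suc γ) (suc i)
  Branch-continue fu γ i p q rewrite p | q = refl

  Branch-add : ∀ fu γ i → memb (i , γ ∸ i) T ≡ false → Branch fu γ i ≡ just (i , γ ∸ i)
  Branch-add fu γ i p rewrite p = refl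

  Branch-terminate : ∀ fu γ i → memb (i , γ ∸ i) T ≡ true → memb (i , suc (γ ∸ i)) T ≡ false → Branch fu γ i ≡ nothing
  Branch-terminate fu γ i p q rewrite p | q = refl

  data HitKind (i : ℕ) : Set where
    above : suc a < g w i → HitKind i
    at-x  : i ≡ x → HitKind i
    at-y  : i ≡ y → HitKind i

  -- One round P(γ, m) of the slide, under the invariant γ = a + #{u < m ∣ g u > a + 1}.
  module Round (γ m : ℕ) (m1 : 1 ≤ m) (mx : m ≤ x) (my : m ≤ y) (γeq : γ ≡ a + countAbove w a m) where
    Hit-x : Hit x ≡ true
    Hit-x = ∨-trueʳ (suc a <ᵇ g w x) _ (∨-trueˡ _ _ (≡ᵇ≡true x x refl))

    Hit-y : Hit y ≡ true
    Hit-y = ∨-trueʳ (suc a <ᵇ g w y) _ (∨-trueʳ (y ≡ᵇ x) _ (≡ᵇ≡true y y refl))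

    open SmallestFrom (smallest (x ∸ m) m Hit (trans (cong Hit (m∸n+n≡m mx)) Hit-x))
      public renaming (least to i; from≤ to m≤i; holds to Hit-i; minimal to no-hit)

    i≤x : i ≤ x
    i≤x = ≤-trans ≤bound (≤-reflexive (m∸n+n≡m mx))

    i-pos : 1 ≤ i
    i-pos = ≤-trans m1 m≤i

    kind : HitKind i
    kind with ∨-true⁻¹ (suc a <ᵇ g w i) _ Hit-i
    ... | inj₁ q = above (<ᵇ≡true⁻¹ _ _ q)
    ... | inj₂ q with ∨-true⁻¹ (i ≡ᵇ x) _ q
    ... | inj₁ r = at-x (≡ᵇ≡true⁻¹ _ _ r)
    ... | inj₂ r = at-y (≡ᵇ≡true⁻¹ _ _ r)

    ≢x : ∀ u → u < i → u ≢ x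
    ≢x u ui with m ≤? u
    ... | yes mu = ≡ᵇ≡false⁻¹ u x (∨-conicalˡ _ _ (∨-conicalʳ (suc a <ᵇ g w u) _ (no-hit u mu ui)))
    ... | no nmu = <⇒≢ (<-≤-trans (≰⇒> nmu) mx)

    ≢y : ∀ u → u < i → u ≢ y
    ≢y u ui with m ≤? u
    ... | yes mu = ≡ᵇ≡false⁻¹ u y (∨-conicalʳ (u ≡ᵇ x) _ (∨-conicalʳ (suc a <ᵇ g w u) _ (no-hit u mu ui)))
    ... | no nmu = <⇒≢ (<-≤-trans (≰⇒> nmu) my)

    i≤y : i ≤ y
    i≤y with i ≤? y
    ... | yes p = p
    ... | no p = ⊥-elim (true≢false (trans (sym Hit-y) (no-hit y my (≰⇒> p))))

    countAbove-gap : ∀ v → m ≤ v → v ≤ i → countAbove w a v ≡ countAbove w a m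
    countAbove-gap v mv vi = count-gap m v _ mv (λ u mu uv → ∨-conicalˡ _ _ (no-hit u mu (<-≤-trans uv vi)))

    γ≡at-i : γ ≡ a + countAbove w a i
    γ≡at-i = trans γeq (cong (a +_) (sym (countAbove-gap i m≤i ≤-refl)))

    i≤γ : i ≤ γ
    i≤γ = ≤-trans (≤-countAbove w i a (λ u ui → ga u (≢x u ui)) (λ u ui → gsa u (≢y u ui))) (≤-reflexive (sym γ≡at-i))

    top-before-i : ∀ v → m ≤ v → v < i → suc (top w v) ≤ γ
    top-before-i v mv vi =
      ≤-trans (top-< w v a gv<a (λ u uv → ga u (≢x u (<-trans uv vi))) (λ u uv → gsa u (≢y u (<-trans uv vi))))
              (≤-reflexive (trans (cong (a +_) (countAbove-gap v mv (<⇒≤ vi))) (sym γeq)))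
      where
      gv<a : g w v < a
      gv<a with <-cmp (g w v) a
      ... | tri< q _ _ = q
      ... | tri≈ _ q _ = ⊥-elim (ga v (≢x v vi) q)
      ... | tri> _ _ q with m≤n⇒m<n∨m≡n q
      ... | inj₂ r = ⊥-elim (gsa v (≢y v vi) (sym r))
      ... | inj₁ r = ⊥-elim (true≢false (trans (sym (<ᵇ≡true _ _ r)) (∨-conicalˡ _ _ (no-hit v mv vi))))

    no-cell-before-i : ∀ v → m ≤ v → v < i → memb (v , (γ ∸ 1) ∸ v) T ≡ false
    no-cell-before-i v mv vi =
      tower-non-memb rep v _ (≤-trans (∸-monoˡ-≤ 1 (top-before-i v mv vi))
                                      (≤-reflexive (sym (m+[n∸m]≡n (∸-monoˡ-≤ 1 (<-≤-trans vi i≤γ))))))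

    top-above : suc a < g w i → suc (suc γ) ≤ top w i
    top-above q = ≤-trans (≤-reflexive (cong (suc ∘ suc) γ≡at-i)) (top-≥ w i a q)

    top-at-x : i ≡ x → top w i ≡ γ
    top-at-x e =
      trans (cong (top w) e)
            (trans (top-≡-at w x a gx (λ u ux → gsa u (≢y u (subst (u <_) (sym e) ux))))
                   (trans (cong (λ v → a + countAbove w a v) (sym e)) (sym γ≡at-i)))

    top-at-y : i ≡ y → top w i ≡ suc γ
    top-at-y e =
      trans (cong (top w) e)
            (trans (top-≡-at-suc w y a gy) (cong suc (trans (cong (λ v → a + countAbove w a v) (sym e)) (sym γ≡at-i))))

    γ≤top : γ ≤ top w i
    γ≤top with kind
    ... | above q = ≤-trans (≤-trans (n≤1+n γ) (n≤1+n (suc γ))) (top-above q)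
    ... | at-x e = ≤-reflexive (sym (top-at-x e))
    ... | at-y e = ≤-trans (n≤1+n γ) (≤-reflexive (sym (top-at-y e)))

    i+[γ∸i] : i + (γ ∸ i) ≡ γ
    i+[γ∸i] = m+[n∸m]≡n i≤γ

    i+[1+γ∸i] : i + suc (γ ∸ i) ≡ suc γ
    i+[1+γ∸i] = trans (+-suc i _) (cong suc i+[γ∸i])

    first-hit : ∀ fu → slideP (suc fu) T γ m ≡ Branch fu γ i
    first-hit fu with i <? γ
    ... | yes i<γ = slideP-hit fu T γ m i
      (findSmallest-just T (γ ∸ 1) (γ ∸ m) m i m≤i (≤-trans i<γ (≤-reflexive (sym (m+[n∸m]≡n (≤-trans m≤i i≤γ))))) no-cell-before-i
         (tower-memb rep i _ i-pos (≤-trans (≤-reflexive (cong suc (m+[n∸m]≡n (∸-monoˡ-≤ 1 i<γ))))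
                                            (≤-trans (≤-reflexive (m+[n∸m]≡n (≤-trans i-pos (<⇒≤ i<γ)))) γ≤top))))
    ... | no i≮γ = trans (slideP-no-hit fu T γ m (findSmallest-nothing T (γ ∸ 1) (γ ∸ m) m no-cell))
                         (cong (Branch fu γ) (sym i≡γ))
      where
      i≡γ : i ≡ γ
      i≡γ = ≤-antisym i≤γ (≮⇒≥ i≮γ)
      no-cell : ∀ v → m ≤ v → v < m + (γ ∸ m) → memb (v , (γ ∸ 1) ∸ v) T ≡ false
      no-cell v mv vγ = no-cell-before-i v mv (<-≤-trans vγ (≤-reflexive (trans (m+[n∸m]≡n (≤-trans m≤i i≤γ)) (sym i≡γ))))

    continue : ∀ fu → suc a < g w i → Branch fu γ i ≡ slideP fu T (suc γ) (suc i)
    continue fu q =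
      Branch-continue fu γ i
        (tower-memb rep i (γ ∸ i) i-pos (≤-trans (≤-reflexive (cong suc i+[γ∸i])) (≤-trans (n≤1+n (suc γ)) (top-above q))))
        (tower-memb rep i (suc (γ ∸ i)) i-pos (≤-trans (≤-reflexive (cong suc i+[1+γ∸i])) (top-above q)))

    next-invariant : suc a < g w i → suc γ ≡ a + countAbove w a (suc i)
    next-invariant q =
      trans (cong suc γ≡at-i) (trans (sym (+-suc a _)) (cong (a +_) (cong (_+ countAbove w a i) (sym (cong ind (<ᵇ≡true _ _ q))))))

    next-below-x : suc a < g w i → i < x
    next-below-x q = ≤∧≢⇒< i≤x (λ e → <-irrefl (sym (trans (cong (g w) e) gx)) (<-trans (n<1+n a) q))

    next-below-y : suc a < g w i → i < y
    next-below-y q = ≤∧≢⇒< i≤y (λ e → <-irrefl (sym (trans (cong (g w) e) gy)) q)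

    next-cell : suc a < g w i → memb (i , suc (γ ∸ i)) T ≡ true
    next-cell q = tower-memb rep i (suc (γ ∸ i)) i-pos (≤-trans (≤-reflexive (cong suc i+[1+γ∸i])) (top-above q))

    add-x : ∀ fu → i ≡ x → Branch fu γ i ≡ result
    add-x fu e =
      trans (Branch-add fu γ i (tower-non-memb rep i (γ ∸ i) (≤-reflexive (trans (top-at-x e) (sym i+[γ∸i])))))
            (trans (cong (λ z → just (z , γ ∸ z)) e)
                   (trans (cong (λ z → just (x , z ∸ x)) (sym (trans (cong (top w) (sym e)) (top-at-x e))))
                          (sym (cong (λ b → if b then just (x , top w x ∸ x) else nothing)
                                     (<ᵇ≡true x y (≤∧≢⇒< (≤-trans (≤-reflexive (sym e)) i≤y) x≢y))))))

    terminate-y : ∀ fu → i ≡ y → Branch fu γ i ≡ result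
    terminate-y fu e =
      trans (Branch-terminate fu γ i
               (tower-memb rep i (γ ∸ i) i-pos (≤-trans (≤-reflexive (cong suc i+[γ∸i])) (≤-reflexive (sym (top-at-y e)))))
               (tower-non-memb rep i (suc (γ ∸ i)) (≤-reflexive (trans (top-at-y e) (sym i+[1+γ∸i])))))
            (sym (cong (λ b → if b then just (x , top w x ∸ x) else nothing)
                       (<ᵇ≡false x y (<⇒≤ (≤∧≢⇒< (≤-trans (≤-reflexive (sym e)) i≤x) (x≢y ∘ sym))))))

  -- fu is fuel: every cell lies on a diagonal ≤ fu + γ, and each round climbs one diagonal
  slide-rounds : ∀ fu γ m → 1 ≤ m → m ≤ x → m ≤ y → γ ≡ a + countAbove w a m →
    (∀ c k → memb (c , k) T ≡ true → c + k ≤ fu + γ) → slideP (suc fu) T γ m ≡ result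
  slide-rounds fu γ m m1 mx my γeq diag = trans (first-hit fu) (branch kind)
    where
    open Round γ m m1 mx my γeq
    branch : HitKind i → Branch fu γ i ≡ result
    branch (at-x e) = add-x fu e
    branch (at-y e) = terminate-y fu e
    branch (above q) = trans (continue fu q) (next fu diag (diag i _ (next-cell q)))
      where
      next : ∀ fu → (∀ c k → memb (c , k) T ≡ true → c + k ≤ fu + γ) → i + suc (γ ∸ i) ≤ fu + γ →
        slideP fu T (suc γ) (suc i) ≡ result
      next zero _ top≤γ = ⊥-elim (<-irrefl refl (≤-trans (≤-reflexive (sym i+[1+γ∸i])) top≤γ))
      next (suc fu') dg _ = slide-rounds fu' (suc γ) (suc i) (s≤s z≤n) (next-below-x q) (next-below-y q) (next-invariant q)
        (λ c k mk → ≤-trans (dg c k mk) (≤-reflexive (sym (+-suc fu' γ))))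

  slide-cell : slideCell a T ≡ result
  slide-cell = slide-rounds (sumDiag T) a 1 ≤-refl x1 y-pos a≡at-1 (λ c k mk → ≤-trans (memb⇒≤sumDiag c k T mk) (m≤m+n _ a))
    where
    a≡at-1 : a ≡ a + countAbove w a 1
    a≡at-1 = sym (trans (cong (λ z → a + (ind (suc a <ᵇ z) + 0)) (g-fix0 w)) (+-identityʳ a))

  slide-ascent : x < y → slideCell a T ≡ just (x , top w x ∸ x)
  slide-ascent lt = trans slide-cell (cong (λ b → if b then just (x , top w x ∸ x) else nothing) (<ᵇ≡true x y lt))

-- Flight paths and corners

diagonal : Cell → ℕ
diagonal (u , v) = u + v

findLargest-nothing : ∀ T d k → (∀ j → 1 ≤ j → j ≤ k → memb (j , d ∸ j) T ≡ false) → findLargest T d k ≡ nothing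
findLargest-nothing T d zero h = refl
findLargest-nothing T d (suc k) h rewrite h (suc k) (s≤s z≤n) ≤-refl = findLargest-nothing T d k (λ j p q → h j p (m≤n⇒m≤1+n q))

findLargest-just : ∀ T d k i → 1 ≤ i → i ≤ k → memb (i , d ∸ i) T ≡ true →
  (∀ j → i < j → j ≤ k → memb (j , d ∸ j) T ≡ false) → findLargest T d k ≡ just i
findLargest-just T d zero i i1 ik mi h with () ← ≤-trans i1 ik
findLargest-just T d (suc k) i i1 ik mi h with i ≟ suc k
... | yes refl rewrite mi = refl
... | no ne rewrite h (suc k) (≤∧≢⇒< ik ne) ≤-refl =
  findLargest-just T d k i i1 (≤-pred (≤∧≢⇒< ik ne)) mi (λ j p q → h j p (m≤n⇒m≤1+n q))

record LargestOnDiagonal (T : List Cell) (d k : ℕ) : Set where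
  field
    column      : ℕ
    found       : findLargest T d k ≡ just column
    column-pos  : 1 ≤ column
    column≤     : column ≤ k
    on-diagonal : memb (column , d ∸ column) T ≡ true
    maximal     : ∀ j → column < j → j ≤ k → memb (j , d ∸ j) T ≡ false

findLargest-some : ∀ T d k j → 1 ≤ j → j ≤ k → memb (j , d ∸ j) T ≡ true → LargestOnDiagonal T d k
findLargest-some T d zero j j1 jk mj with () ← ≤-trans j1 jk
findLargest-some T d (suc k) j j1 jk mj with memb (suc k , d ∸ suc k) T in eq
... | true = record { column = suc k ; found = cong (λ b → if b then just (suc k) else findLargest T d k) eq ; column-pos = s≤s z≤n ; column≤ = ≤-refl
                    ; on-diagonal = eq ; maximal = λ j' p q → ⊥-elim (<⇒≱ p q) }
... | false with j ≟ suc k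
... | yes refl with () ← trans (sym mj) eq
... | no ne with findLargest-some T d k j j1 (≤-pred (≤∧≢⇒< jk ne)) mj
... | r = record { LargestOnDiagonal r
               ; found = trans (cong (λ b → if b then just (suc k) else findLargest T d k) eq) found
               ; column≤ = m≤n⇒m≤1+n column≤ ; maximal = λ j' p q → case j' p (m≤n⇒m<n∨m≡n q) }
  where
  open LargestOnDiagonal r using (column; found; column≤; maximal)
  case : ∀ j' → column < j' → (j' < suc k) ⊎ (j' ≡ suc k) → memb (j' , d ∸ j') T ≡ false
  case j' p (inj₁ r) = maximal j' p (≤-pred r)
  case j' p (inj₂ refl) = eq

flightPathF-base : ∀ n T i j → findLargest T (i + j ∸ 1) (i ∸ 1) ≡ nothing → flightPathF (suc n) T (i , j) ≡ just ((i , j) ∷ [])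
flightPathF-base n T i j e rewrite e = refl

flightPathF-blocked : ∀ n T i j i' → findLargest T (i + j ∸ 1) (i ∸ 1) ≡ just i' →
  memb (i' , suc (i + j ∸ 1 ∸ i')) T ≡ false → flightPathF (suc n) T (i , j) ≡ nothing
flightPathF-blocked n T i j i' e m rewrite e | m = refl

flightPathF-step : ∀ n T i j i' p → findLargest T (i + j ∸ 1) (i ∸ 1) ≡ just i' → memb (i' , suc (i + j ∸ 1 ∸ i')) T ≡ true →
  flightPathF n T (i' , i + j ∸ 1 ∸ i') ≡ just p → flightPathF (suc n) T (i , j) ≡ just ((i , j) ∷ (i' , suc (i + j ∸ 1 ∸ i')) ∷ p)
flightPathF-step n T i j i' p e m r rewrite e | m | r = refl

flightPathF-step-nothing : ∀ n T i j i' → findLargest T (i + j ∸ 1) (i ∸ 1) ≡ just i' → memb (i' , suc (i + j ∸ 1 ∸ i')) T ≡ true →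
  flightPathF n T (i' , i + j ∸ 1 ∸ i') ≡ nothing → flightPathF (suc n) T (i , j) ≡ nothing
flightPathF-step-nothing n T i j i' e m r rewrite e | m | r = refl

lexMin-smaller-column : ∀ u c s k rest → u < c → lexMin (c , k) ((u , s) ∷ rest) ≡ lexMin (u , s) rest
lexMin-smaller-column u c s k rest lt rewrite <ᵇ≡true u c lt = refl

lexMin-lower-cell : ∀ u t rest → lexMin (u , suc t) ((u , t) ∷ rest) ≡ lexMin (u , t) rest
lexMin-lower-cell u t rest rewrite <ᵇ≡false u u ≤-refl | ≡ᵇ≡true u u refl | <ᵇ≡true t (suc t) ≤-refl = refl

flightNumber-of-path : ∀ T c q → flightPath T c ≡ just (c ∷ q) → flightNumber T c ≡ just (diagonal (lexMin c q))
flightNumber-of-path T (c1 , c2) q e rewrite e = refl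

diag-memb : ∀ {T w} → TowerOf T w → ∀ j d → 1 ≤ j → j ≤ d → suc d ≤ top w j → memb (j , d ∸ j) T ≡ true
diag-memb rep j d j1 jd le = tower-memb rep j (d ∸ j) j1 (≤-trans (≤-reflexive (cong suc (m+[n∸m]≡n jd))) le)

diag-non-memb : ∀ {T w} → TowerOf T w → ∀ j d → j ≤ d → top w j ≤ d → memb (j , d ∸ j) T ≡ false
diag-non-memb rep j d jd le = tower-non-memb rep j (d ∸ j) (≤-trans le (≤-reflexive (sym (m+[n∸m]≡n jd))))

-- The flight path of a cell (c , k) on the diagonal a + #{u < c ∣ g u > a + 1} jumps, at each step, to the
-- largest earlier column u with g u > a + 1; it ends on the diagonal a.
module DescentFlight (w : Perm) (a : ℕ) (a1 : 1 ≤ a) (desc : f w (suc a) < f w a) (T : List Cell) (rep : TowerOf T w) where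
  open Letter w a
  Above : ℕ → Bool
  Above u = suc a <ᵇ g w u

  Above⇒pos : ∀ u → Above u ≡ true → 1 ≤ u
  Above⇒pos zero p = ⊥-elim (true≢false (trans (sym p) (trans (cong (suc a <ᵇ_) (g-fix0 w)) (<ᵇ≡false (suc a) 0 z≤n))))
  Above⇒pos (suc u) p = s≤s z≤n

  g<a : ∀ u → u < y → Above u ≡ false → g w u < a
  g<a u uy pf with <-cmp (g w u) a
  ... | tri< q _ _ = q
  ... | tri≈ _ q _ = ⊥-elim (ga u (<⇒≢ (<-trans uy desc)) q)
  ... | tri> _ _ q with m≤n⇒m<n∨m≡n q
  ... | inj₂ r = ⊥-elim (gsa u (<⇒≢ uy) (sym r))
  ... | inj₁ r = ⊥-elim (true≢false (trans (sym (<ᵇ≡true _ _ r)) pf))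

  top-below : ∀ u c → u < c → c ≤ y → Above u ≡ false → suc (top w u) ≤ a + countAbove w a u
  top-below u c uc cy pf = top-< w u a (g<a u (<-≤-trans uc cy) pf)
     (λ v vu → ga v (<⇒≢ (<-trans vu (<-trans (<-≤-trans uc cy) desc))))
     (λ v vu → gsa v (<⇒≢ (<-trans vu (<-≤-trans uc cy))))

  flight-invariant : ∀ n c k → 1 ≤ c → c ≤ y → c + k ≡ a + countAbove w a c → c ≤ n →
    Σ (List Cell) λ q → flightPathF n T (c , k) ≡ just ((c , k) ∷ q) × diagonal (lexMin (c , k) q) ≡ a
  flight-invariant zero c k c1 cy ceq cn with () ← ≤-trans c1 cn
  flight-invariant (suc n) c k c1 cy ceq cn with largest c Above
  ... | inj₁ none = [] , flightPathF-base n T c k (findLargest-nothing T d (c ∸ 1) λ j j1 jc → diag-non-memb rep j d (jd j jc) (top≤d j jc)) ,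
                    trans ceq (trans (cong (a +_) (count-none c Above none)) (+-identityʳ a))
    where
    d = c + k ∸ 1
    jd : ∀ j → j ≤ c ∸ 1 → j ≤ d
    jd j jc = ≤-trans jc (∸-monoˡ-≤ 1 (m≤m+n c k))
    top≤d : ∀ j → j ≤ c ∸ 1 → top w j ≤ d
    top≤d j jc = ∸-monoˡ-≤ 1 (≤-trans (top-below j c j<c cy (none j j<c))
                                      (≤-trans (+-monoʳ-≤ a (count-mono-bound j c Above (<⇒≤ j<c))) (≤-reflexive (sym ceq))))
      where j<c : j < c
            j<c = ≤-<-trans jc (≤-reflexive (m+[n∸m]≡n c1))
  ... | inj₂ (u , uc , Above-u , u-max) = (u , suc (d ∸ u)) ∷ (u , d ∸ u) ∷ q' , path , diagonal-eq
    where
    d = c + k ∸ 1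
    u1 : 1 ≤ u
    u1 = Above⇒pos u Above-u
    d≡ : d ≡ a + countAbove w a u
    d≡ = cong (_∸ 1) (trans ceq (trans (cong (a +_) (trans (count-gap (suc u) c Above uc u-max)
                                                                (cong (_+ countAbove w a u) (cong ind Above-u))))
                                        (+-suc a _)))
    u≤d : u ≤ d
    u≤d = ∸-monoˡ-≤ 1 (≤-trans uc (m≤m+n c k))
    top-u : suc (suc d) ≤ top w u
    top-u = ≤-trans (≤-reflexive (cong (suc ∘ suc) d≡)) (top-≥ w u a (<ᵇ≡true⁻¹ _ _ Above-u))
    largest-u : findLargest T d (c ∸ 1) ≡ just u
    largest-u = findLargest-just T d (c ∸ 1) u u1 (∸-monoˡ-≤ 1 uc) (diag-memb rep u d u1 u≤d (≤-trans (n≤1+n _) top-u))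
           (λ j uj jc → diag-non-memb rep j d (≤-trans jc (∸-monoˡ-≤ 1 (m≤m+n c k))) (top≤d j uj jc))
      where
      top≤d : ∀ j → u < j → j ≤ c ∸ 1 → top w j ≤ d
      top≤d j uj jc = ∸-monoˡ-≤ 1 (≤-trans (top-below j c j<c cy (u-max j uj j<c)) (≤-reflexive (trans (cong (a +_) same-count) (sym ceq))))
        where
        j<c : j < c
        j<c = ≤-<-trans jc (≤-reflexive (m+[n∸m]≡n c1))
        same-count : countAbove w a j ≡ countAbove w a c
        same-count = sym (count-gap j c Above (<⇒≤ j<c) (λ v p q → u-max v (<-≤-trans uj p) q))
    cell-above : memb (u , suc (d ∸ u)) T ≡ true
    cell-above = tower-memb rep u (suc (d ∸ u)) u1 (≤-trans (≤-reflexive (cong suc (trans (+-suc u _) (cong suc (m+[n∸m]≡n u≤d))))) top-u)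
    rec = flight-invariant n u (d ∸ u) u1 (<⇒≤ (<-≤-trans uc cy)) (trans (m+[n∸m]≡n u≤d) d≡) (≤-pred (≤-trans uc cn))
    q' = proj₁ rec
    path : flightPathF (suc n) T (c , k) ≡ just ((c , k) ∷ (u , suc (d ∸ u)) ∷ (u , d ∸ u) ∷ q')
    path = flightPathF-step n T c k u _ largest-u cell-above (proj₁ (proj₂ rec))
    diagonal-eq : diagonal (lexMin (c , k) ((u , suc (d ∸ u)) ∷ (u , d ∸ u) ∷ q')) ≡ a
    diagonal-eq = trans (cong diagonal (trans (lexMin-smaller-column u c (suc (d ∸ u)) k ((u , d ∸ u) ∷ q') uc)
                                              (lexMin-lower-cell u (d ∸ u) q')))
                        (proj₂ (proj₂ rec))

  top-cell-flight : ∀ k → y + suc k ≡ top w y →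
    Σ (List Cell) λ q → flightPath T (y , k) ≡ just ((y , k) ∷ q) × diagonal (lexMin (y , k) q) ≡ a
  top-cell-flight k e = flight-invariant y y k y-pos ≤-refl (suc-injective (trans (sym (+-suc y k)) (trans e (top-≡-at-suc w y a gy)))) ≤-refl

  flightNumber-descent : ∀ k → y + suc k ≡ top w y → flightNumber T (y , k) ≡ just a
  flightNumber-descent k e with top-cell-flight k e
  ... | q , path , diag = trans (flightNumber-of-path T (y , k) q path) (cong just diag)

  flightPath-descent : ∀ k → y + suc k ≡ top w y → HasFlightPath T (y , k)
  flightPath-descent k e with top-cell-flight k e
  ... | q , path , _ = _ , path

-- Dually, below an ascent the flight path of the top cell of column y either meets a missing cell or
-- keeps jumping along columns c with x < c, so it never exists.
module AscentNoFlight (w : Perm) (b : ℕ) (b1 : 1 ≤ b) (asc : f w b < f w (suc b)) (T : List Cell) (rep : TowerOf T w) where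
  open Letter w b
  Above : ℕ → Bool
  Above u = suc b <ᵇ g w u

  x1 : 1 ≤ x
  x1 = f-pos w b1

  Above-x : Above x ≡ false
  Above-x = trans (cong (suc b <ᵇ_) gx) (<ᵇ≡false (suc b) b (n≤1+n b))

  Above⇒pos : ∀ u → Above u ≡ true → 1 ≤ u
  Above⇒pos zero p = ⊥-elim (true≢false (trans (sym p) (trans (cong (suc b <ᵇ_) (g-fix0 w)) (<ᵇ≡false (suc b) 0 z≤n))))
  Above⇒pos (suc u) p = s≤s z≤n

  top-x : top w x ≡ b + countAbove w b x
  top-x = top-≡-at w x b gx (λ u ux → gsa u (<⇒≢ (<-trans ux asc)))

  module Jump (c k : ℕ) (xc : x < c) (cy : c ≤ y) (ceq : c + k ≡ b + countAbove w b c) where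
    d = c + k ∸ 1
    c1 : 1 ≤ c
    c1 = ≤-trans x1 (<⇒≤ xc)
    j<c : ∀ {j} → j ≤ c ∸ 1 → j < c
    j<c jc = ≤-<-trans jc (≤-reflexive (m+[n∸m]≡n c1))
    j≤d : ∀ {j} → j ≤ c ∸ 1 → j ≤ d
    j≤d jc = ≤-trans jc (∸-monoˡ-≤ 1 (m≤m+n c k))
    1+d : suc d ≡ c + k
    1+d = m+[n∸m]≡n (≤-trans c1 (m≤m+n c k))

    x-on-diagonal : (∀ v → x ≤ v → v < c → Above v ≡ false) → memb (x , d ∸ x) T ≡ true
    x-on-diagonal h = diag-memb rep x d x1 (j≤d (∸-monoˡ-≤ 1 xc))
      (≤-reflexive (trans 1+d (trans ceq (trans (cong (b +_) (count-gap x c Above (<⇒≤ xc) h)) (sym top-x)))))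

    top-last-above : ∀ u → u < c → Above u ≡ true → (∀ v → u < v → v < c → Above v ≡ false) → suc (c + k) ≤ top w u
    top-last-above u uc Au um =
      ≤-trans (≤-reflexive (cong suc (trans ceq (trans (cong (b +_) count-c) (+-suc b _))))) (top-≥ w u b (<ᵇ≡true⁻¹ _ _ Au))
      where
      count-c : countAbove w b c ≡ suc (countAbove w b u)
      count-c = trans (count-gap (suc u) c Above uc um) (cong (_+ countAbove w b u) (cong ind Au))

    last-above-on-diagonal : ∀ u → u < c → Above u ≡ true → (∀ v → u < v → v < c → Above v ≡ false) → memb (u , d ∸ u) T ≡ true
    last-above-on-diagonal u uc Au um =
      diag-memb rep u d (Above⇒pos u Au) (j≤d (∸-monoˡ-≤ 1 uc)) (≤-trans (≤-trans (≤-reflexive 1+d) (n≤1+n _)) (top-last-above u uc Au um))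

    some-on-diagonal : Σ ℕ λ j → 1 ≤ j × j ≤ c ∸ 1 × memb (j , d ∸ j) T ≡ true
    some-on-diagonal with largest c Above
    ... | inj₁ none = x , x1 , ∸-monoˡ-≤ 1 xc , x-on-diagonal (λ v _ vc → none v vc)
    ... | inj₂ (u , uc , Au , um) with x <? u
    ... | yes xu = u , Above⇒pos u Au , ∸-monoˡ-≤ 1 uc , last-above-on-diagonal u uc Au um
    ... | no x≮u = x , x1 , ∸-monoˡ-≤ 1 xc , x-on-diagonal none-from-x
      where
      none-from-x : ∀ v → x ≤ v → v < c → Above v ≡ false
      none-from-x v xv vc with u <? v
      ... | yes uv = um v uv vc
      ... | no u≮v = ⊥-elim (x≮u (≤∧≢⇒< (≤-trans xv (≮⇒≥ u≮v)) (λ e → true≢false (trans (sym Au) (trans (cong Above (sym e)) Above-x)))))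

    open LargestOnDiagonal (findLargest-some T d (c ∸ 1) (proj₁ some-on-diagonal) (proj₁ (proj₂ some-on-diagonal))
                              (proj₁ (proj₂ (proj₂ some-on-diagonal))) (proj₂ (proj₂ (proj₂ some-on-diagonal))))
      public renaming (column to i; found to largest-i; column-pos to i-pos; column≤ to i≤; on-diagonal to i-on-diagonal; maximal to i-maximal)

    above-after-last : ∀ i' → (∀ j → i' < j → j ≤ c ∸ 1 → memb (j , d ∸ j) T ≡ false) → ∀ v → i' < v → v < c → Above v ≡ false
    above-after-last i' i'-max v iv vc with Above v in Av | largest c Above
    ... | false | _ = refl
    ... | true | inj₁ none = ⊥-elim (true≢false (trans (sym Av) (none v vc)))
    ... | true | inj₂ (u , uc , Au , um) with i' <? u
    ... | yes iu = ⊥-elim (true≢false (trans (sym (last-above-on-diagonal u uc Au um)) (i'-max u iu (∸-monoˡ-≤ 1 uc))))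
    ... | no i≮u with u <? v
    ... | yes uv = ⊥-elim (true≢false (trans (sym Av) (um v uv vc)))
    ... | no u≮v = ⊥-elim (u≮v (≤-<-trans (≮⇒≥ i≮u) iv))

    above-after-i : ∀ v → i < v → v < c → Above v ≡ false
    above-after-i = above-after-last i i-maximal

    blocked : ∀ n → Above i ≡ false → flightPathF (suc n) T (c , k) ≡ nothing
    blocked n Ai = flightPathF-blocked n T c k i largest-i
      (tower-non-memb rep i (suc (d ∸ i)) (≤-trans top-i (≤-reflexive (sym (trans (+-suc i _) (trans (cong suc (m+[n∸m]≡n (j≤d i≤))) 1+d))))))
      where
      g≤b : g w i ≤ b
      g≤b with g w i ≤? b
      ... | yes p = p
      ... | no p with m≤n⇒m<n∨m≡n (≰⇒> p)
      ... | inj₁ r = ⊥-elim (true≢false (trans (sym (<ᵇ≡true _ _ r)) Ai))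
      ... | inj₂ r = ⊥-elim (gsa i (<⇒≢ (<-≤-trans (j<c i≤) cy)) (sym r))
      top-i : top w i ≤ c + k
      top-i = ≤-trans (top-≤ w i b g≤b (λ u ui → gsa u (<⇒≢ (<-trans ui (<-≤-trans (j<c i≤) cy)))))
                      (≤-trans (+-monoʳ-≤ b (count-mono-bound i c Above (<⇒≤ (j<c i≤)))) (≤-reflexive (sym ceq)))

    next-diagonal : Above i ≡ true → i + (d ∸ i) ≡ b + countAbove w b i
    next-diagonal Ai = trans (m+[n∸m]≡n (j≤d i≤)) (cong (_∸ 1) (trans ceq (trans (cong (b +_) count-c) (+-suc b _))))
      where
      count-c : countAbove w b c ≡ suc (countAbove w b i)
      count-c = trans (count-gap (suc i) c Above (j<c i≤) above-after-i) (cong (_+ countAbove w b i) (cong ind Ai))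

    next-cell : Above i ≡ true → memb (i , suc (d ∸ i)) T ≡ true
    next-cell Ai = tower-memb rep i (suc (d ∸ i)) i-pos
      (≤-trans (≤-reflexive (cong suc (trans (+-suc i _) (cong suc (next-diagonal Ai)))))
               (top-≥ w i b (<ᵇ≡true⁻¹ _ _ Ai)))

    x<i : Above i ≡ true → x < i
    x<i Ai with <-cmp x i
    ... | tri< q _ _ = q
    ... | tri≈ _ q _ = ⊥-elim (true≢false (trans (sym Ai) (trans (cong Above (sym q)) Above-x)))
    ... | tri> _ _ q = ⊥-elim (true≢false (trans (sym (x-on-diagonal (λ v xv vc → above-after-i v (<-≤-trans q xv) vc)))
                                                 (i-maximal x q (∸-monoˡ-≤ 1 xc))))

  no-flight-invariant : ∀ n c k → x < c → c ≤ y → c + k ≡ b + countAbove w b c → flightPathF n T (c , k) ≡ nothing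
  no-flight-invariant zero c k xc cy ceq = refl
  no-flight-invariant (suc n) c k xc cy ceq with Above (Jump.i c k xc cy ceq) in Ai
  ... | false = Jump.blocked c k xc cy ceq n Ai
  ... | true = flightPathF-step-nothing n T c k i largest-i (next-cell Ai)
                 (no-flight-invariant n i (d ∸ i) (x<i Ai) (<⇒≤ (<-≤-trans (j<c i≤) cy)) (next-diagonal Ai))
    where open Jump c k xc cy ceq

  no-flightPath : ∀ k → y + suc k ≡ top w y → flightPath T (y , k) ≡ nothing
  no-flightPath k e = no-flight-invariant y y k asc ≤-refl (suc-injective (trans (sym (+-suc y k)) (trans e (top-≡-at-suc w y b gy))))

just≢nothing : ∀ {A : Set} {v : A} → just v ≢ nothing
just≢nothing ()

top-of-corner : ∀ {T w} → TowerOf T w → ∀ i j → memb (i , j) T ≡ true → memb (i , suc j) T ≡ false → i + suc j ≡ top w i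
top-of-corner rep i j m1 m2 =
  ≤-antisym (≤-trans (≤-reflexive (+-suc i j)) (tower-memb⁻¹ rep i j m1))
            (≮⇒≥ (λ lt → true≢false (trans (sym (tower-memb rep i (suc j) (tower-col-pos rep i j m1) lt)) m2)))

record CornerLetter (w : Perm) (T : List Cell) (i j : ℕ) : Set where
  field
    letter     : ℕ
    letter-pos : 1 ≤ letter
    column     : f w (suc letter) ≡ i
    descent    : f w (suc letter) < f w letter
    top-cell   : i + suc j ≡ top w i
    flight     : flightNumber T (i , j) ≡ just letter

-- A corner (i , j) is the top cell of column i = w (a + 1); a is a descent because at an ascent the top
-- cell of that column has no flight path, and then its flight number is a.
corner-letter : ∀ {T} w → TowerOf T w → ∀ i j → memb (i , j) T ≡ true → memb (i , suc j) T ≡ false → HasFlightPath T (i , j) →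
  CornerLetter w T i j
corner-letter {T} w rep i j m1 m2 (p , fpe) with g w i in gi
... | zero = ⊥-elim (<⇒≢ (g-pos w i-pos) (sym gi))
  where i-pos = tower-col-pos rep i j m1
... | suc zero = ⊥-elim (<⇒≱ (≤-trans (s≤s (m≤m+n i j)) (≤-trans (≤-reflexive (sym (+-suc i j))) (≤-reflexive top-eq))) top≤i)
  where
  i-pos = tower-col-pos rep i j m1
  top-eq = top-of-corner rep i j m1 m2
  top≤i : top w i ≤ i
  top≤i = ≤-trans (≤-reflexive (cong (_+ inversionsLeft w i) gi))
                  (≤-trans (s≤s (count-false-at-0 i _ (trans (cong (g w i <ᵇ_) (g-fix0 w)) (<ᵇ≡false (g w i) 0 z≤n))))
                           (≤-reflexive (m+[n∸m]≡n i-pos)))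
... | suc (suc a') = record
  { letter = a ; letter-pos = s≤s z≤n ; column = fi ; descent = fd ; top-cell = top-eq
  ; flight = subst (λ z → flightNumber T (z , j) ≡ just a) fi
                   (DescentFlight.flightNumber-descent w a (s≤s z≤n) fd T rep j (subst (λ z → z + suc j ≡ top w z) (sym fi) top-eq)) }
  where
  a = suc a'
  i-pos = tower-col-pos rep i j m1
  top-eq = top-of-corner rep i j m1 m2
  fi : f w (suc a) ≡ i
  fi = trans (cong (f w) (sym gi)) (fg w i)
  fd : f w (suc a) < f w a
  fd with <-cmp (f w a) i
  ... | tri> _ _ q = ≤-trans (s≤s (≤-reflexive fi)) q
  ... | tri≈ _ q _ = ⊥-elim (1+n≢n (sym (f-injective w (trans q (sym fi)))))
  ... | tri< q _ _ = ⊥-elim (just≢nothing (trans (sym fpe) no-path))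
    where
    open AscentNoFlight w a (s≤s z≤n) (<-≤-trans q (≤-reflexive (sym fi))) T rep
    no-path : flightPath T (i , j) ≡ nothing
    no-path = subst (λ z → flightPath T (z , j) ≡ nothing) fi (no-flightPath j (subst (λ z → z + suc j ≡ top w z) (sym fi) top-eq))

CornerStep : List Cell → Cell → Set
CornerStep T c = IsTowerDiagram T × IsCorner T c

CornerChain : List Cell → Set
CornerChain cs = ∀ ds c rest → cs ≡ ds ++ c ∷ rest → CornerStep (ds ++ [ c ]) c

decomp : ∀ (ds : List Cell) c ds' c' rest → ds ++ [ c ] ≡ ds' ++ c' ∷ rest →
  (rest ≡ [] × ds ≡ ds' × c ≡ c') ⊎ (Σ (List Cell) λ r → ds ≡ ds' ++ c' ∷ r)
decomp [] c [] c' rest e with ∷-injective e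
... | refl , refl = inj₁ (refl , refl , refl)
decomp (d ∷ ds) c [] c' rest e with ∷-injective e
... | refl , _ = inj₂ (ds , refl)
decomp [] c (d' ∷ ds') c' rest e with ∷-injective e
... | _ , e2 = ⊥-elim (nil≢ ds' c' rest e2)
  where
  nil≢ : ∀ (ds' : List Cell) c' rest → [] ≢ ds' ++ c' ∷ rest
  nil≢ [] c' rest ()
  nil≢ (_ ∷ _) c' rest ()
decomp (d ∷ ds) c (d' ∷ ds') c' rest e with ∷-injective e
... | refl , e2 with decomp ds c ds' c' rest e2
... | inj₁ (r1 , r2 , r3) = inj₁ (r1 , cong (d ∷_) r2 , r3)
... | inj₂ (r , e3) = inj₂ (r , cong (d ∷_) e3)

CornerChain-[] : CornerChain []
CornerChain-[] [] c rest ()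
CornerChain-[] (_ ∷ _) c rest ()

CornerChain-snoc : ∀ ds c → CornerChain ds → CornerStep (ds ++ [ c ]) c → CornerChain (ds ++ [ c ])
CornerChain-snoc ds c pi x ds' c' rest e with decomp ds c ds' c' rest e
... | inj₁ (refl , refl , refl) = x
... | inj₂ (r , e') = pi ds' c' r e'

CornerChain-init : ∀ ds c → CornerChain (ds ++ [ c ]) → CornerChain ds × CornerStep (ds ++ [ c ]) c
CornerChain-init ds c pi = (λ ds' c' rest e → pi ds' c' (rest ++ [ c ]) (trans (cong (_++ [ c ]) e) (++-assoc ds' (c' ∷ rest) [ c ]))) , pi ds c [] refl

take-lookup : ∀ (cs : List Cell) (k : Fin (length cs)) → take (suc (toℕ k)) cs ≡ take (toℕ k) cs ++ [ lookup cs k ]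
take-lookup (c ∷ cs) fzero = refl
take-lookup (c ∷ cs) (fsuc k) = cong (c ∷_) (take-lookup cs k)

split-lookup : ∀ (cs : List Cell) (k : Fin (length cs)) → cs ≡ take (toℕ k) cs ++ lookup cs k ∷ drop (suc (toℕ k)) cs
split-lookup (c ∷ cs) fzero = refl
split-lookup (c ∷ cs) (fsuc k) = cong (c ∷_) (split-lookup cs k)

idx : ∀ (ds : List Cell) c rest → Σ (Fin (length (ds ++ c ∷ rest))) λ k → take (suc (toℕ k)) (ds ++ c ∷ rest) ≡ ds ++ [ c ] × lookup (ds ++ c ∷ rest) k ≡ c
idx [] c rest = fzero , refl , refl
idx (d ∷ ds) c rest with idx ds c rest
... | k , e1 , e2 = fsuc k , cong (d ∷_) e1 , e2

CornerChain⇒STT : ∀ cs → CornerChain cs → ∀ (k : Fin (length cs)) → IsTowerDiagram (take (suc (toℕ k)) cs) × IsCorner (take (suc (toℕ k)) cs) (lookup cs k)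
CornerChain⇒STT cs pi k rewrite take-lookup cs k = pi (take (toℕ k) cs) (lookup cs k) (drop (suc (toℕ k)) cs) (split-lookup cs k)

STT⇒CornerChain : ∀ cs → (∀ (k : Fin (length cs)) → IsTowerDiagram (take (suc (toℕ k)) cs) × IsCorner (take (suc (toℕ k)) cs) (lookup cs k)) → CornerChain cs
STT⇒CornerChain cs h ds c rest refl with idx ds c rest
... | k , e1 , e2 = subst₂ CornerStep e1 e2 (h k)

All-snoc : ∀ {P : Cell → Set} xs c → All P xs → P c → All P (xs ++ [ c ])
All-snoc xs c p q = AllP.++⁺ p (q ∷ [])

Unique-snoc : ∀ (xs : List Cell) c → Unique xs → c ∉ xs → Unique (xs ++ [ c ])
Unique-snoc [] c [] nc = [] ∷ []
Unique-snoc (x ∷ xs) c (px ∷ u) nc = All-snoc xs c px (λ e → nc (here (sym e))) ∷ Unique-snoc xs c u (λ m → nc (there m))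

Unique-init : ∀ (xs : List Cell) c → Unique (xs ++ [ c ]) → Unique xs × c ∉ xs
Unique-init [] c u = [] , λ ()
Unique-init (x ∷ xs) c (px ∷ u) with Unique-init xs c u
... | u' , nc = (AllP.++⁻ˡ xs px ∷ u') , λ { (here refl) → lastNe xs px refl ; (there m) → nc m }
  where
  lastNe : ∀ (xs : List Cell) → All (x ≢_) (xs ++ [ c ]) → x ≢ c
  lastNe [] (p ∷ []) = p
  lastNe (_ ∷ xs) (_ ∷ ps) = lastNe xs ps

readAux-snoc : ∀ pre xs c → readAux pre (xs ++ [ c ]) ≡ readAux pre xs ++ [ fromMaybe 0 (flightNumber (pre ++ xs ++ [ c ]) c) ]
readAux-snoc pre [] c = refl
readAux-snoc pre (x ∷ xs) c rewrite readAux-snoc (pre ++ [ x ]) xs c | ++-assoc pre [ x ] (xs ++ [ c ]) = refl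

Read-snoc : ∀ xs c a → flightNumber (xs ++ [ c ]) c ≡ just a → Read (xs ++ [ c ]) ≡ Read xs ++ [ a ]
Read-snoc xs c a e = trans (readAux-snoc [] xs c) (cong (λ m → Read xs ++ [ fromMaybe 0 m ]) e)

srAux-cons : ∀ acc a α d → slideCell a acc ≡ just d → srAux acc (a ∷ α) ≡ srAux (acc ++ [ d ]) α
srAux-cons acc a α d e rewrite e = refl

srAux-snoc : ∀ acc β cs a d → srAux acc β ≡ just cs → slideCell a cs ≡ just d → srAux acc (β ++ [ a ]) ≡ just (cs ++ [ d ])
srAux-snoc acc [] cs a d refl e rewrite e = refl
srAux-snoc acc (b ∷ β) cs a d e1 e2 with slideCell b acc
... | just d' = srAux-snoc (acc ++ [ d' ]) β cs a d e1 e2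

towerOf-isTowerDiagram : ∀ {T w} → TowerOf T w → IsTowerDiagram T
towerOf-isTowerDiagram {T} rep =
  (λ {i} {j} m → tower-col-pos rep i j (∈⇒memb _ T m)) ,
  (λ {i} {j} {k} m kj → memb⇒∈ _ T (tower-memb rep i k (tower-col-pos rep i j (∈⇒memb _ T m))
                                        (≤-<-trans (+-monoʳ-≤ i kj) (tower-memb⁻¹ rep i j (∈⇒memb _ T m)))))

Ascending : (ℕ → ℕ) → List ℕ → Set
Ascending h [] = ⊤
Ascending h (a ∷ α) = h a < h (suc a) × Ascending (λ n → h (s a n)) α

Ascending-snoc : ∀ h β a → Ascending h β → h (evalWord β a) < h (evalWord β (suc a)) → Ascending h (β ++ [ a ])
Ascending-snoc h [] a tt lt = lt , tt
Ascending-snoc h (b ∷ β) a (p , ps) lt = p , Ascending-snoc (λ n → h (s b n)) β a ps lt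

applyWord : (w : Perm) → ∀ {α} → All (1 ≤_) α → Perm
applyWord w [] = w
applyWord w (p ∷ ps) = applyWord (mulS w _ p) ps

applyWord-f : ∀ w {α} (ps : All (1 ≤_) α) x → f (applyWord w ps) x ≡ f w (evalWord α x)
applyWord-f w [] x = refl
applyWord-f w (p ∷ ps) x = applyWord-f (mulS w _ p) ps x

evalWord-snoc : ∀ β a x → evalWord (β ++ [ a ]) x ≡ evalWord β (s a x)
evalWord-snoc [] a x = refl
evalWord-snoc (b ∷ β) a x = cong (s b) (evalWord-snoc β a x)

top-cong : ∀ w₁ w₂ → (∀ n → g w₁ n ≡ g w₂ n) → ∀ c → top w₁ c ≡ top w₂ c
top-cong w₁ w₂ h c = cong₂ _+_ (h c) (count-cong c (λ u _ → cong₂ _<ᵇ_ (h c) (h u)))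

inTower-cong : ∀ w₁ w₂ → (∀ n → g w₁ n ≡ g w₂ n) → ∀ z → inTower w₁ z ≡ inTower w₂ z
inTower-cong w₁ w₂ h (c , k) = cong (λ m → (0 <ᵇ c) ∧ (c + k <ᵇ m)) (top-cong w₁ w₂ h c)

g-cong : ∀ w₁ w₂ → (∀ n → f w₁ n ≡ f w₂ n) → ∀ n → g w₁ n ≡ g w₂ n
g-cong w₁ w₂ h n = trans (sym (gf w₂ (g w₁ n))) (cong (g w₂) (trans (sym (h (g w₁ n))) (fg w₁ n)))

TowerOf-cong : ∀ T w₁ w₂ → (∀ n → g w₁ n ≡ g w₂ n) → TowerOf T w₁ → TowerOf T w₂
TowerOf-cong T w₁ w₂ h rep = towerOf λ z → trans (memb≡inTower rep z) (inTower-cong w₁ w₂ h z)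

g-fixed-step : ∀ w c → (∀ u → u < c → g w u ≡ u) → top w c ≡ c → g w c ≡ c
g-fixed-step w c h Gc with <-cmp (g w c) c
... | tri≈ _ q _ = q
... | tri> _ _ q = ⊥-elim (<⇒≱ q (≤-trans (m≤m+n (g w c) _) (≤-reflexive Gc)))
... | tri< q _ _ = ⊥-elim (<⇒≢ q (g-injective w (h (g w c) q)))

g-fixed-below : ∀ w n → (∀ c → c < n → top w c ≡ c) → ∀ c → c < n → g w c ≡ c
g-fixed-below w zero h c ()
g-fixed-below w (suc n) h c cn with m≤n⇒m<n∨m≡n (≤-pred cn)
... | inj₁ q = g-fixed-below w n (λ c' p → h c' (m≤n⇒m≤1+n p)) c q
... | inj₂ refl = g-fixed-step w c (g-fixed-below w c (λ c' p → h c' (m≤n⇒m≤1+n p))) (h c cn)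

g-fixed⇒f-fixed : ∀ w n → g w n ≡ n → f w n ≡ n
g-fixed⇒f-fixed w n e = trans (cong (f w) (sym e)) (fg w n)

TowerOf-[]⇒id : ∀ w → TowerOf [] w → ∀ n → f w n ≡ n
TowerOf-[]⇒id w rep n = g-fixed⇒f-fixed w n (g-fixed-below w (suc n) (λ c _ → top≡ c) n ≤-refl)
  where
  top≡ : ∀ c → top w c ≡ c
  top≡ zero = trans (+-identityʳ (g w 0)) (g-fix0 w)
  top≡ (suc c) = ≤-antisym (≤-trans (<ᵇ≡false⁻¹ (suc c + 0) _ (sym (memb≡inTower rep (suc c , 0)))) (≤-reflexive (+-identityʳ (suc c))))
                           (≤-top w (suc c))

record SRState (cs : List Cell) (w : Perm) : Set where
  constructor srState
  field
    tower  : TowerOf cs w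
    unique : Unique cs
    chain  : CornerChain cs

module AddAscent (w : Perm) (a : ℕ) (a1 : 1 ≤ a) (asc : f w a < f w (suc a)) (acc : List Cell) (st : SRState acc w) where
  open Letter w a
  open SRState st

  k : ℕ
  k = top w x ∸ x

  cell : Cell
  cell = x , k

  w' : Perm
  w' = mulS w a a1

  acc' : List Cell
  acc' = acc ++ [ cell ]

  tower' : TowerOf acc' w'
  tower' = AscentStep.TowerOf-mulS w a a1 asc acc tower

  x+k : x + k ≡ top w x
  x+k = m+[n∸m]≡n (≤-top w x)

  top' : top w' x ≡ suc (top w x)
  top' = trans (AscentStep.top-mulS w a a1 asc x) (trans (cong (λ b → top w x + ind b) (≡ᵇ≡true x x refl)) (+-comm (top w x) 1))

  slide : slideCell a acc ≡ just cell
  slide = Slide.slide-ascent w a a1 acc tower asc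

  -- in w' the letter a is a descent whose lower value is x, so cell is the top of column w' (a + 1)
  x≡y' : f w' (suc a) ≡ x
  x≡y' = cong (f w) (s-at-suc a)

  descent' : f w' (suc a) < f w' a
  descent' = subst₂ _<_ (sym x≡y') (sym (cong (f w) (s-at a))) asc

  top-cell' : f w' (suc a) + suc k ≡ top w' (f w' (suc a))
  top-cell' = subst (λ z → z + suc k ≡ top w' z) (sym x≡y') (trans (+-suc x k) (trans (cong suc x+k) (sym top')))

  flight : flightNumber acc' cell ≡ just a
  flight = subst (λ z → flightNumber acc' (z , k) ≡ just a) x≡y'
                 (DescentFlight.flightNumber-descent w' a a1 descent' acc' tower' k top-cell')

  corner : IsCorner acc' cell
  corner = memb⇒∈ cell acc' (tower-memb tower' x k (f-pos w a1) (≤-trans (≤-reflexive (cong suc x+k)) (≤-reflexive (sym top'))))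
         , memb-false⇒∉ (x , suc k) acc' (tower-non-memb tower' x (suc k) (≤-reflexive (trans top' (trans (cong suc (sym x+k)) (sym (+-suc x k))))))
         , subst (λ z → HasFlightPath acc' (z , k)) x≡y' (DescentFlight.flightPath-descent w' a a1 descent' acc' tower' k top-cell')

  next : SRState acc' w'
  next = srState tower'
                 (Unique-snoc acc cell unique (memb-false⇒∉ cell acc (tower-non-memb tower x k (≤-reflexive (sym x+k)))))
                 (CornerChain-snoc acc cell chain (towerOf-isTowerDiagram tower' , corner))

sr-ascending : ∀ α w acc (ps : All (1 ≤_) α) → Ascending (f w) α → SRState acc w →
  Σ (List Cell) λ cs → srAux acc α ≡ just cs × SRState cs (applyWord w ps) × Read cs ≡ Read acc ++ α
sr-ascending [] w acc [] tt st = acc , refl , st , sym (++-identityʳ (Read acc))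
sr-ascending (a ∷ α) w acc (a1 ∷ ps) (asc , ascs) st =
  let (cs , sr , st' , rd) = sr-ascending α w' acc' ps ascs next
  in cs , trans (srAux-cons acc a α cell slide) sr , st'
        , trans rd (trans (cong (_++ α) (Read-snoc acc cell a flight)) (++-assoc (Read acc) [ a ] α))
  where open AddAscent w a a1 asc acc st

∉⇒memb-false : ∀ z T → z ∉ T → memb z T ≡ false
∉⇒memb-false z T nz with memb z T in eq
... | false = refl
... | true = ⊥-elim (nz (memb⇒∈ z T eq))

-- Removing the last cell c of a recording: c is a corner, hence sits over a descent a of w, and the
-- remaining cells describe w s_a, for which a is an ascent whose slide adds c back.
module RemoveCorner (w : Perm) (ds : List Cell) (c : Cell) (st : SRState (ds ++ [ c ]) w) where
  open SRState st
  i = proj₁ c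
  j = proj₂ c

  step = CornerChain-init ds c chain
  corner = proj₂ (proj₂ step)

  open CornerLetter (corner-letter w tower i j (∈⇒memb c _ (proj₁ corner)) (∉⇒memb-false (i , suc j) _ (proj₁ (proj₂ corner))) (proj₂ (proj₂ corner)))
    public renaming (letter to a; letter-pos to a1; column to column-i; descent to descent-a; top-cell to top-i)

  w' : Perm
  w' = mulS w a a1

  ascent' : f w' a < f w' (suc a)
  ascent' = subst₂ _<_ (sym (cong (f w) (s-at a))) (sym (cong (f w) (s-at-suc a))) descent-a

  x'≡i : f w' a ≡ i
  x'≡i = trans (cong (f w) (s-at a)) column-i

  w'-back : ∀ n → g (mulS w' a a1) n ≡ g w n
  w'-back n = s-involutive a (g w n)

  top-w : ∀ z → top w z ≡ top w' z + ind (z ≡ᵇ f w' a)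
  top-w z = trans (sym (top-cong (mulS w' a a1) w w'-back z)) (AscentStep.top-mulS w' a a1 ascent' z)

  top-w'-i : top w' i ≡ i + j
  top-w'-i = suc-injective (trans (trans (+-comm 1 (top w' i)) (cong (λ b → top w' i + ind b) (sym (≡ᵇ≡true i (f w' a) (sym x'≡i)))))
                                  (trans (sym (top-w i)) (trans (sym top-i) (+-suc i j))))

  added-cell : (f w' a , top w' (f w' a) ∸ f w' a) ≡ c
  added-cell rewrite x'≡i | top-w'-i = cong (i ,_) (m+n∸m≡n i j)

  inTower-w : ∀ z → inTower w z ≡ (inTower w' z ∨ (z ==c c))
  inTower-w z = trans (sym (inTower-cong (mulS w' a a1) w w'-back z))
                      (trans (AscentStep.inTower-mulS w' a a1 ascent' z) (cong (λ q → inTower w' z ∨ (z ==c q)) added-cell))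

  unique-ds = Unique-init ds c unique

  tower-ds : ∀ z → memb z ds ≡ inTower w' z
  tower-ds z with z ==c c in ez
  ... | true rewrite ==c-true⁻¹ (proj₁ z) (proj₂ z) i j ez =
    trans (∉⇒memb-false c ds (proj₂ unique-ds)) (sym (∧-falseʳ (0 <ᵇ i) _ (<ᵇ≡false (i + j) (top w' i) (≤-reflexive top-w'-i))))
  ... | false = begin
    memb z ds                        ≡⟨ sym (∨-identityʳ (memb z ds)) ⟩
    memb z ds ∨ false                ≡⟨ cong (memb z ds ∨_) (sym ez) ⟩
    memb z ds ∨ (z ==c c)            ≡⟨ sym (memb-++ z ds c) ⟩
    memb z (ds ++ [ c ])             ≡⟨ memb≡inTower tower z ⟩
    inTower w z                      ≡⟨ inTower-w z ⟩
    inTower w' z ∨ (z ==c c)         ≡⟨ cong (inTower w' z ∨_) ez ⟩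
    inTower w' z ∨ false             ≡⟨ ∨-identityʳ _ ⟩
    inTower w' z                     ∎
    where open ≡-Reasoning

  previous : SRState ds w'
  previous = srState (towerOf tower-ds) (proj₁ unique-ds) (proj₁ step)

  slide : slideCell a ds ≡ just c
  slide = trans (Slide.slide-ascent w' a a1 ds (towerOf tower-ds) ascent') (cong just added-cell)

  read : Read (ds ++ [ c ]) ≡ Read ds ++ [ a ]
  read = Read-snoc ds c a flight

record RecordingWord (w : Perm) (cs : List Cell) (ρ : List ℕ) : Set where
  field
    positive  : All (1 ≤_) ρ
    evaluates : ∀ n → evalWord ρ n ≡ f w n
    ascending : Ascending id ρ
    records   : srAux [] ρ ≡ just cs

read-recording : ∀ {cs} → Reverse cs → ∀ w → SRState cs w → RecordingWord w cs (Read cs)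
read-recording [] w st = record
  { positive = [] ; evaluates = λ n → sym (TowerOf-[]⇒id w (SRState.tower st) n) ; ascending = tt ; records = refl }
read-recording (ds ∶ r ∶ʳ c) w st = subst (RecordingWord w (ds ++ [ c ])) (sym read) (record
  { positive  = AllP.++⁺ positive (a1 ∷ [])
  ; evaluates = λ n → trans (evalWord-snoc (Read ds) a n) (trans (evaluates (s a n)) (cong (f w) (s-involutive a n)))
  ; ascending = Ascending-snoc id (Read ds) a ascending (subst₂ _<_ (sym (evaluates a)) (sym (evaluates (suc a))) ascent')
  ; records   = srAux-snoc [] (Read ds) ds a c records slide
  })
  where
  open RemoveCorner w ds c st
  open RecordingWord (read-recording r w' previous)

sumTo : ℕ → (ℕ → ℕ) → ℕ
sumTo zero F = 0
sumTo (suc K) F = F K + sumTo K F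

sumTo-cong : ∀ K F F' → (∀ c → c < K → F c ≡ F' c) → sumTo K F ≡ sumTo K F'
sumTo-cong zero F F' h = refl
sumTo-cong (suc K) F F' h = cong₂ _+_ (h K ≤-refl) (sumTo-cong K F F' (λ c p → h c (m≤n⇒m≤1+n p)))

sumTo-bump : ∀ K F F' x → x < K → (∀ c → F' c ≡ F c + ind (c ≡ᵇ x)) → sumTo K F' ≡ suc (sumTo K F)
sumTo-bump zero F F' x () h
sumTo-bump (suc K) F F' x lt h with K ≟ x
... | yes refl =
  trans (cong₂ _+_ (trans (h K) (cong (λ b → F K + ind b) (≡ᵇ≡true K K refl)))
                   (sumTo-cong K F' F (λ c p → trans (h c) (trans (cong (λ b → F c + ind b) (≡ᵇ≡false c K (<⇒≢ p))) (+-identityʳ (F c))))))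
        (cong (_+ sumTo K F) (+-comm (F K) 1))
... | no ne =
  trans (cong₂ _+_ (trans (h K) (trans (cong (λ b → F K + ind b) (≡ᵇ≡false K x ne)) (+-identityʳ (F K))))
                   (sumTo-bump K F F' x (≤∧≢⇒< (≤-pred lt) (ne ∘ sym)) h))
        (+-suc (F K) _)

sumTo-zero : ∀ K F → sumTo K F ≡ 0 → ∀ c → c < K → F c ≡ 0
sumTo-zero (suc K) F e c lt with m≤n⇒m<n∨m≡n (≤-pred lt)
... | inj₁ q = sumTo-zero K F (m+n≡0⇒n≡0 (F K) e) c q
... | inj₂ refl = m+n≡0⇒m≡0 (F c) e

sumTo-pos : ∀ K F n → sumTo K F ≡ suc n → Σ ℕ λ c → c < K × 1 ≤ F c
sumTo-pos zero F n ()
sumTo-pos (suc K) F n e with F K in eq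
... | suc m = K , ≤-refl , ≤-trans (s≤s z≤n) (≤-reflexive (sym eq))
... | zero with sumTo-pos K F n e
... | c , p , q = c , m≤n⇒m≤1+n p , q

-- Inversion counts and reduced words

-- the number of cells of the tower diagram of w (its number of inversions), provided w fixes every n ≥ K
inversionCount : Perm → ℕ → ℕ
inversionCount w K = sumTo K (λ c → top w c ∸ c)

inversionCount-cong : ∀ w₁ w₂ K → (∀ n → g w₁ n ≡ g w₂ n) → inversionCount w₁ K ≡ inversionCount w₂ K
inversionCount-cong w₁ w₂ K h = sumTo-cong K _ _ (λ c _ → cong (_∸ c) (top-cong w₁ w₂ h c))

FixesFrom : Perm → ℕ → Set
FixesFrom w K = ∀ n → K ≤ n → f w n ≡ n

module _ (w : Perm) (K : ℕ) (fixes : FixesFrom w K) where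
  f-< : ∀ a → a < K → f w a < K
  f-< a lt with f w a <? K
  ... | yes p = p
  ... | no p = ⊥-elim (<⇒≱ lt (≤-trans (≮⇒≥ p) (≤-reflexive (f-injective w (fixes (f w a) (≮⇒≥ p))))))

  g-fixes : ∀ n → K ≤ n → g w n ≡ n
  g-fixes n p = trans (cong (g w) (sym (fixes n p))) (gf w n)

  g-< : ∀ c → c < K → g w c < K
  g-< c lt with g w c <? K
  ... | yes p = p
  ... | no p = ⊥-elim (<⇒≱ lt (≤-trans (≮⇒≥ p) (≤-reflexive (trans (sym (fixes (g w c) (≮⇒≥ p))) (fg w c)))))

  FixesFrom-mulS : ∀ a (a1 : 1 ≤ a) → suc a < K → FixesFrom (mulS w a a1) K
  FixesFrom-mulS a a1 lt n p =
    trans (cong (f w) (s-other a n (λ { refl → <⇒≱ (<-trans (n<1+n a) lt) p }) (λ { refl → <⇒≱ lt p }))) (fixes n p)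

  inversionCount-ascent : ∀ a (a1 : 1 ≤ a) → suc a < K → f w a < f w (suc a) → inversionCount (mulS w a a1) K ≡ suc (inversionCount w K)
  inversionCount-ascent a a1 lt asc = sumTo-bump K _ _ (f w a) (f-< a (<-trans (n<1+n a) lt))
    (λ c → trans (cong (_∸ c) (AscentStep.top-mulS w a a1 asc c)) (+-∸-comm _ (≤-top w c)))


inversionCount-descent : ∀ w K → FixesFrom w K → ∀ a (a1 : 1 ≤ a) → suc a < K → f w (suc a) < f w a →
  suc (inversionCount (mulS w a a1) K) ≡ inversionCount w K
inversionCount-descent w K fixes a a1 lt d =
  trans (sym (inversionCount-ascent w' K (FixesFrom-mulS w K fixes a a1 lt) a a1 lt asc'))
        (inversionCount-cong (mulS w' a a1) w K (λ n → s-involutive a (g w n)))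
  where
  w' = mulS w a a1
  asc' : f w' a < f w' (suc a)
  asc' = subst₂ _<_ (sym (cong (f w) (s-at a))) (sym (cong (f w) (s-at-suc a))) d

inversionCount-mulS-≤ : ∀ w K → FixesFrom w K → ∀ a (a1 : 1 ≤ a) → suc a < K → inversionCount (mulS w a a1) K ≤ suc (inversionCount w K)
inversionCount-mulS-≤ w K fixes a a1 lt with <-cmp (f w a) (f w (suc a))
... | tri< asc _ _ = ≤-reflexive (inversionCount-ascent w K fixes a a1 lt asc)
... | tri≈ _ e _ = ⊥-elim (1+n≢n (sym (f-injective w e)))
... | tri> _ _ d = ≤-trans (n≤1+n _) (≤-trans (≤-reflexive (inversionCount-descent w K fixes a a1 lt d)) (n≤1+n _))

inversionCount-applyWord-≤ : ∀ w K {α} (ps : All (1 ≤_) α) → FixesFrom w K → All (λ a → suc a < K) α →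
  inversionCount (applyWord w ps) K ≤ inversionCount w K + length α
inversionCount-applyWord-≤ w K [] fixes _ = ≤-reflexive (sym (+-identityʳ _))
inversionCount-applyWord-≤ w K {a ∷ α} (p ∷ ps) fixes (l ∷ ls) =
  ≤-trans (inversionCount-applyWord-≤ (mulS w a p) K ps (FixesFrom-mulS w K fixes a p l) ls)
          (≤-trans (+-monoˡ-≤ (length α) (inversionCount-mulS-≤ w K fixes a p l)) (≤-reflexive (sym (+-suc _ _))))

inversionCount-ascending : ∀ w K {α} (ps : All (1 ≤_) α) → FixesFrom w K → All (λ a → suc a < K) α → Ascending (f w) α →
  inversionCount (applyWord w ps) K ≡ inversionCount w K + length α
inversionCount-ascending w K [] fixes _ _ = sym (+-identityʳ _)
inversionCount-ascending w K {a ∷ α} (p ∷ ps) fixes (l ∷ ls) (asc , ascs) =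
  trans (inversionCount-ascending (mulS w a p) K ps (FixesFrom-mulS w K fixes a p l) ls ascs)
        (trans (cong (_+ length α) (inversionCount-ascent w K fixes a p l asc)) (sym (+-suc _ _)))

ascending-or-wasteful : ∀ w K {α} (ps : All (1 ≤_) α) → FixesFrom w K → All (λ a → suc a < K) α →
  Ascending (f w) α ⊎ (inversionCount (applyWord w ps) K + 2 ≤ inversionCount w K + length α)
ascending-or-wasteful w K [] fixes _ = inj₁ tt
ascending-or-wasteful w K {a ∷ α} (p ∷ ps) fixes (l ∷ ls) with <-cmp (f w a) (f w (suc a))
... | tri≈ _ e _ = ⊥-elim (1+n≢n (sym (f-injective w e)))
... | tri> _ _ d =
  inj₂ (≤-trans (+-monoˡ-≤ 2 (inversionCount-applyWord-≤ (mulS w a p) K ps (FixesFrom-mulS w K fixes a p l) ls))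
                (≤-reflexive (trans (+-comm _ 2) (trans (cong suc (sym (+-suc _ _)))
                                                        (cong (_+ suc (length α)) (inversionCount-descent w K fixes a p l d))))))
... | tri< asc _ _ with ascending-or-wasteful (mulS w a p) K ps (FixesFrom-mulS w K fixes a p l) ls
... | inj₁ ascs = inj₁ (asc , ascs)
... | inj₂ h = inj₂ (≤-trans h (≤-reflexive (trans (cong (_+ length α) (inversionCount-ascent w K fixes a p l asc)) (sym (+-suc _ _)))))

descent-between : ∀ w q p → p < q → f w q < f w p → Σ ℕ λ a → p ≤ a × a < q × f w (suc a) < f w a
descent-between w zero p () lt
descent-between w (suc q) p pq lt with <-cmp (f w (suc q)) (f w q)
... | tri< d _ _ = q , ≤-pred pq , ≤-refl , d
... | tri≈ _ e _ = ⊥-elim (1+n≢n (f-injective w e))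
... | tri> _ _ a with p ≟ q
... | yes refl = ⊥-elim (<-asym a lt)
... | no ne with descent-between w q p (≤∧≢⇒< (≤-pred pq) ne) (<-trans a lt)
... | r , x1 , x2 , x3 = r , x1 , m≤n⇒m≤1+n x2 , x3

-- The first nonempty column c has c < g c, because g fixes every earlier column; so f descends
-- somewhere between c and g c.
descent-of-positive-count : ∀ w K n → FixesFrom w K → inversionCount w K ≡ suc n →
  Σ ℕ λ a → 1 ≤ a × suc a < K × f w (suc a) < f w a
descent-of-positive-count w K n fixes e =
  let (a , c≤a , a<gc , desc) = descent-between w (g w c) c c<g (subst (_< f w c) (sym (fg w c)) c<f)
  in a , ≤-trans c-pos c≤a , <-≤-trans (s≤s a<gc) (g-< w K fixes c c<K) , desc
  where
  pos = sumTo-pos K _ n e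
  Nonempty : ℕ → Bool
  Nonempty c = 0 <ᵇ (top w c ∸ c)
  open SmallestFrom (smallest (proj₁ pos) 0 Nonempty (trans (cong Nonempty (+-identityʳ (proj₁ pos))) (<ᵇ≡true 0 _ (proj₂ (proj₂ pos)))))
    renaming (least to c)
  c<K : c < K
  c<K = ≤-<-trans (≤-trans ≤bound (≤-reflexive (+-identityʳ (proj₁ pos)))) (proj₁ (proj₂ pos))
  height-pos : 0 < top w c ∸ c
  height-pos = <ᵇ≡true⁻¹ 0 _ holds
  height-0 : top w 0 ∸ 0 ≡ 0
  height-0 = trans (+-identityʳ (g w 0)) (g-fix0 w)
  c-pos : 1 ≤ c
  c-pos = ≤∧≢⇒< z≤n (λ e → <⇒≱ height-pos (≤-reflexive (trans (cong (λ v → top w v ∸ v) (sym e)) height-0)))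
  g-id-below : ∀ u → u < c → g w u ≡ u
  g-id-below = g-fixed-below w c (λ u uc → ≤-antisym (m∸n≡0⇒m≤n (n≤0⇒n≡0 (<ᵇ≡false⁻¹ 0 _ (minimal u z≤n uc)))) (≤-top w u))
  c≤g : c ≤ g w c
  c≤g with <-cmp (g w c) c
  ... | tri< q _ _ = ⊥-elim (<⇒≢ q (g-injective w (g-id-below (g w c) q)))
  ... | tri≈ _ q _ = ≤-reflexive (sym q)
  ... | tri> _ _ q = <⇒≤ q
  top≡g : top w c ≡ g w c
  top≡g = trans (cong (g w c +_) (count-none c _ (λ u uc → <ᵇ≡false (g w c) (g w u) (≤-trans (≤-reflexive (g-id-below u (uc))) (≤-trans (<⇒≤ uc) c≤g)))))
                (+-identityʳ _)
  c<g : c < g w c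
  c<g = ≤-trans (≤-trans (≤-reflexive (+-comm 1 c)) (≤-trans (+-monoʳ-≤ c height-pos) (≤-reflexive (m+[n∸m]≡n (≤-top w c)))))
                (≤-reflexive top≡g)
  c<f : c < f w c
  c<f with <-cmp (f w c) c
  ... | tri< q _ _ = ⊥-elim (<⇒≢ q (trans (sym (g-id-below (f w c) q)) (gf w c)))
  ... | tri≈ _ q _ = ⊥-elim (<⇒≢ c<g (sym (trans (cong (g w) (sym q)) (gf w c))))
  ... | tri> _ _ q = q

-- sorting w by successively undoing descents
word-of-inversionCount : ∀ n w K → FixesFrom w K → inversionCount w K ≡ n →
  Σ (List ℕ) λ β → All (1 ≤_) β × (∀ x → evalWord β x ≡ f w x) × length β ≡ n
word-of-inversionCount zero w K fixes e = [] , [] , (λ x → sym (g-fixed⇒f-fixed w x (g-id x))) , refl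
  where
  g-id : ∀ n → g w n ≡ n
  g-id n with n <? K
  ... | yes p = g-fixed-below w K (λ c lt → ≤-antisym (m∸n≡0⇒m≤n (sumTo-zero K _ e c lt)) (≤-top w c)) n p
  ... | no p = g-fixes w K fixes n (≮⇒≥ p)
word-of-inversionCount (suc n) w K fixes e =
  let (a , a1 , aK , desc) = descent-of-positive-count w K n fixes e
      (β , ones , ev , len) = word-of-inversionCount n (mulS w a a1) K (FixesFrom-mulS w K fixes a a1 aK)
                                (suc-injective (trans (inversionCount-descent w K fixes a a1 aK desc) e))
  in β ++ [ a ] , AllP.++⁺ ones (a1 ∷ []) ,
     (λ x → trans (evalWord-snoc β a x) (trans (ev (s a x)) (cong (f w) (s-involutive a x)))) ,
     trans (length-++ β) (trans (+-comm (length β) 1) (cong suc len))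

toPerm : FinPerm → Perm
toPerm ω = record { f = FinPerm.fun ω ; g = FinPerm.inv ω ; fg = FinPerm.fun∘inv ω ; gf = FinPerm.inv∘fun ω ; f0 = FinPerm.fix0 ω }

idPerm : Perm
idPerm = record { f = λ n → n ; g = λ n → n ; fg = λ n → refl ; gf = λ n → refl ; f0 = refl }

top-id : ∀ c → top idPerm c ≡ c
top-id c = trans (cong (c +_) (count-none c _ (λ u uc → <ᵇ≡false c u (<⇒≤ uc)))) (+-identityʳ c)

inversionCount-id : ∀ K → inversionCount idPerm K ≡ 0
inversionCount-id zero = refl
inversionCount-id (suc K) = cong₂ _+_ (trans (cong (_∸ K) (top-id K)) (n∸n≡0 K)) (inversionCount-id K)

TowerOf-[]-id : TowerOf [] idPerm
TowerOf-[]-id = towerOf λ { (c , k) → sym (∧-falseʳ (0 <ᵇ c) _ (<ᵇ≡false (c + k) _ (≤-trans (≤-reflexive (top-id c)) (m≤m+n c k)))) }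

letterSum : List ℕ → ℕ
letterSum [] = 0
letterSum (a ∷ as) = a + letterSum as

letters-< : ∀ α K → letterSum α + 2 ≤ K → All (λ a → suc a < K) α
letters-< [] K p = []
letters-< (a ∷ α) K p =
  ≤-trans (≤-reflexive (+-comm 2 a)) (≤-trans (+-monoˡ-≤ 2 (m≤m+n a (letterSum α))) p) ∷
  letters-< α K (≤-trans (+-monoˡ-≤ 2 (m≤n+m (letterSum α) a)) p)

applyWord-id : ∀ ω α (ps : All (1 ≤_) α) → (∀ n → evalWord α n ≡ FinPerm.fun ω n) → ∀ n → g (applyWord idPerm ps) n ≡ g (toPerm ω) n
applyWord-id ω α ps ev = g-cong (applyWord idPerm ps) (toPerm ω) (λ n → trans (applyWord-f idPerm ps n) (ev n))

-- K lies beyond the support of ω and beyond every letter used, so inversion counts below K see everything.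
reduced⇒ascending : ∀ ω α → IsReducedWord ω α → Ascending id α
reduced⇒ascending ω α ((ones , ev) , minimal) = [ id , (λ wasteful → ⊥-elim (<⇒≱ (m<m+n N (s≤s z≤n)) (≤-trans (too-long wasteful) shortest))) ]′
                                                   (ascending-or-wasteful idPerm K ones (λ n _ → refl) (letters-< α K (m≤n+m (letterSum α + 2) (FinPerm.bound ω))))
  where
  K = FinPerm.bound ω + (letterSum α + 2)
  N = inversionCount (toPerm ω) K
  too-long : inversionCount (applyWord idPerm ones) K + 2 ≤ inversionCount idPerm K + length α → N + 2 ≤ length α
  too-long wasteful =
    ≤-trans (≤-reflexive (cong (_+ 2) (sym (inversionCount-cong (applyWord idPerm ones) (toPerm ω) K (applyWord-id ω α ones ev)))))
            (≤-trans wasteful (≤-reflexive (cong (_+ length α) (inversionCount-id K))))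
  shortest : length α ≤ N
  shortest = let (β , onesβ , evβ , len) = word-of-inversionCount N (toPerm ω) K (λ n p → FinPerm.fixes ω n (≤-trans (m≤m+n _ _) p)) refl
             in ≤-trans (minimal β (onesβ , evβ)) (≤-reflexive len)

ascending⇒reduced : ∀ ω α → All (1 ≤_) α → (∀ n → evalWord α n ≡ FinPerm.fun ω n) → Ascending id α → IsReducedWord ω α
ascending⇒reduced ω α ones ev asc = (ones , ev) , shortest
  where
  shortest : ∀ β → IsWordOf ω β → length α ≤ length β
  shortest β (onesβ , evβ) = begin
    length α                                  ≡⟨ cong (_+ length α) (sym (inversionCount-id K)) ⟩
    inversionCount idPerm K + length α        ≡⟨ sym (inversionCount-ascending idPerm K ones (λ n _ → refl) (lettersOf α (m≤m+n _ _)) asc) ⟩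
    inversionCount (applyWord idPerm ones) K  ≡⟨ inversionCount-cong (applyWord idPerm ones) (applyWord idPerm onesβ) K same-g ⟩
    inversionCount (applyWord idPerm onesβ) K ≤⟨ inversionCount-applyWord-≤ idPerm K onesβ (λ n _ → refl) (lettersOf β (m≤n+m _ _)) ⟩
    inversionCount idPerm K + length β        ≡⟨ cong (_+ length β) (inversionCount-id K) ⟩
    length β                                  ∎
    where
    open ≤-Reasoning
    K = FinPerm.bound ω + ((letterSum α + letterSum β) + 2)
    lettersOf : ∀ γ → letterSum γ ≤ letterSum α + letterSum β → All (λ a → suc a < K) γ
    lettersOf γ le = letters-< γ K (≤-trans (+-monoˡ-≤ 2 le) (m≤n+m _ (FinPerm.bound ω)))
    same-g : ∀ n → g (applyWord idPerm ones) n ≡ g (applyWord idPerm onesβ) n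
    same-g n = trans (applyWord-id ω α ones ev n) (sym (applyWord-id ω β onesβ evβ n))

sr-reduced : ∀ ω α → IsReducedWord ω α → Σ (List Cell) λ cs → R α ≡ just cs × SRState cs (toPerm ω) × Read cs ≡ α
sr-reduced ω α red@((ones , ev) , _) =
  let (cs , sr , srState tw u ch , rd) = sr-ascending α idPerm [] ones (reduced⇒ascending ω α red) (srState TowerOf-[]-id [] CornerChain-[])
  in cs , sr , srState (TowerOf-cong cs _ _ (applyWord-id ω α ones ev) tw) u ch , rd

shapeR-tower : ∀ ω α₀ → IsReducedWord ω α₀ → ∀ z → ShapeR α₀ z ⇔ (inTower (toPerm ω) z ≡ true)
shapeR-tower ω α₀ red z with sr-reduced ω α₀ red
... | cs₀ , e₀ , st₀ , _ = mk⇔ to (λ t → cs₀ , e₀ , memb⇒∈ z cs₀ (trans (memb≡inTower (SRState.tower st₀) z) t))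
  where
  to : ShapeR α₀ z → inTower (toPerm ω) z ≡ true
  to (cs , e , m) with just-injective (trans (sym e) e₀)
  ... | refl = trans (sym (memb≡inTower (SRState.tower st₀) z)) (∈⇒memb z cs m)

SRState⇒STT : ∀ {𝒯 w} → (∀ z → 𝒯 z ⇔ (inTower w z ≡ true)) → ∀ cs → SRState cs w → IsSTT 𝒯 cs
SRState⇒STT shape cs (srState tower unique chain) =
  unique ,
  (λ z → mk⇔ (λ m → Equivalence.from (shape z) (trans (sym (memb≡inTower tower z)) (∈⇒memb z cs m)))
             (λ t → memb⇒∈ z cs (trans (memb≡inTower tower z) (Equivalence.to (shape z) t)))) ,
  CornerChain⇒STT cs chain

STT⇒SRState : ∀ {𝒯 w} → (∀ z → 𝒯 z ⇔ (inTower w z ≡ true)) → ∀ cs → IsSTT 𝒯 cs → SRState cs w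
STT⇒SRState shape cs (unique , cells , corners) =
  srState (towerOf λ z → bool-ext (λ m → Equivalence.to (shape z) (Equivalence.to (cells z) (memb⇒∈ z cs m)))
                                  (λ t → ∈⇒memb z cs (Equivalence.from (cells z) (Equivalence.from (shape z) t))))
          unique (STT⇒CornerChain cs corners)

theorem4p4 : (ω : FinPerm) (α₀ : List ℕ) → IsReducedWord ω α₀ →
    ((cs : List Cell) → IsSTT (ShapeR α₀) cs →
       IsReducedWord ω (Read cs) × R (Read cs) ≡ just cs) ×
    ((α : List ℕ) → IsReducedWord ω α →
       ∃ λ cs → R α ≡ just cs × IsSTT (ShapeR α₀) cs × Read cs ≡ α)
theorem4p4 ω α₀ red₀ = read-reduced , record-reduced
  where
  shape = shapeR-tower ω α₀ red₀

  read-reduced : (cs : List Cell) → IsSTT (ShapeR α₀) cs → IsReducedWord ω (Read cs) × R (Read cs) ≡ just cs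
  read-reduced cs stt = ascending⇒reduced ω (Read cs) positive evaluates ascending , records
    where open RecordingWord (read-recording (reverseView cs) (toPerm ω) (STT⇒SRState shape cs stt))

  record-reduced : (α : List ℕ) → IsReducedWord ω α → ∃ λ cs → R α ≡ just cs × IsSTT (ShapeR α₀) cs × Read cs ≡ α
  record-reduced α red = let (cs , sr , st , rd) = sr-reduced ω α red in cs , sr , SRState⇒STT shape cs st , rd
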